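{- Let $n\geqslant 1$, let $T$ be a staircase tableau of size $n$, $w=w(T)$ and $m=\mathrm{type}(T)$. Then: $w(\mathrm{insertion}(T,\alpha))=q^{|\circ(m)|}\alpha w$ and its type is $\bullet m$; $w(\mathrm{insertion}(T,\beta))=\beta w$ and its type is $\circ m$; $w(\mathrm{insertion}(T,\gamma))=q^{|\circ(m)|}\gamma w$ and its type is $\circ m$; $w(\mathrm{insertion}(T,\delta))=q^{n}\delta w$ and its type is $\bullet m$. Moreover, for each $i\in\{1,\dots,n\}$, writing $m=U\,m_i\,V$ with $U=m_n\cdots m_{i+1}$ and $V=m_{i-1}\cdots m_1$: $w(\mathrm{insertion}(T,(\alpha,\beta,i)))=q^{|\circ(U)|}\alpha\beta w$ and its type is $\bullet U\circ V$; $w(\mathrm{insertion}(T,(\gamma,\beta,i)))=q^{|\circ(U)|}\gamma\beta w$ and its type is $\circ U\circ V$; $w(\mathrm{insertion}(T,(\alpha,\delta,i)))=q^{|\circ(U)|+|V|}\alpha\delta w$ and its type is $\bullet U\bullet V$; $w(\mathrm{insertion}(T,(\gamma,\delta,i)))=q^{|\circ(U)|+|V|}\gamma\delta w$ and its type is $\circ U\bullet V$.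
   Context: Staircase tableaux. For $n\geqslant 1$, the staircase shape of size $n$ is the set of cells $(i,j)$ with $1\leqslant j\leqslant i\leqslant n$ ($i$ = row, $j$ = column), rows numbered from bottom to top and columns from left to right; row $i$ consists of $(i,1),\dots,(i,i)$, column $j$ consists of $(j,j),\dots,(n,j)$ from bottom to top, and $c_i=(i,i)$. A staircase tableau of size $n$ is a filling in which each cell is empty or labelled by one of $\alpha,\beta,\gamma,\delta$, such that every $c_i$ is labelled; all cells above (in the same column) a cell labelled $\alpha$ or $\gamma$ are empty; all cells to the left (in the same row) of a cell labelled $\beta$ or $\delta$ are empty. Row $i$ is of type $\alpha/\gamma$ if $c_i$ is labelled $\alpha$ or $\gamma$. Type: $\mathrm{type}(T)=m_n\cdots m_1\in\{\bullet,\circ\}^n$ where $m_i=\bullet$ if $c_i$ is labelled $\alpha$ or $\delta$ and $m_i=\circ$ if $c_i$ is labelled $\beta$ or $\gamma$. For a word $X$, $|X|$ is its length and $|\circ(X)|$ its number of letters $\circ$. Weight (with the convention $u=1$): for an empty cell $e$, let $r(e)$ be the nearest labelled cell to the right of $e$ in its row and $b(e)$ the nearest labelled cell below $e$ in its column (both exist since diagonal cells are labelled). The cell $e$ receives $q$ if $r(e)$ is labelled $\delta$, or if $r(e)$ is labelled $\alpha$ or $\gamma$ and $b(e)$ is labelled $\beta$ or $\gamma$; otherwise it receives $1$. The weight $w(T)\in\mathbb{Z}[\alpha,\beta,\gamma,\delta,q]$ is the product of all labels of $T$ times $q^{N}$, where $N$ is the number of empty cells receiving $q$. Elementary operations: for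 rows $i_1<i_2$, $L_{i_1}\to L_{i_2}$ (allowed when row $i_2$ is entirely empty) moves the content of $(i_1,k)$ to $(i_2,k)$ for all $1\leqslant k\leqslant i_1$, emptying $(i_1,k)$; $L^*_{i_1}\to L_{i_2}$ (allowed when row $i_2$ is empty except $c_{i_2}$) does this for $1\leqslant k<i_1$ only. Insertion into $T$ of size $n$: adding $L_{n+1}(z)$ means adding above $T$ a row $n+1$ with cells $(n+1,1),\dots,(n+1,n+1)$, all empty except $c_{n+1}$ labelled $z$. (1) For $y\in\{\beta,\delta\}$: $\mathrm{insertion}(T,y)$ is $T$ with $L_{n+1}(y)$ added. (2) For $x\in\{\alpha,\gamma\}$: add $L_{n+1}(x)$, let $i_1<\dots<i_k=n+1$ be the indices of the rows of type $\alpha/\gamma$, and perform successively $L^*_{i_{k-1}}\to L_{i_k},\dots,L^*_{i_1}\to L_{i_2}$; this is $\mathrm{insertion}(T,x)$. (3) For $x\in\{\alpha,\gamma\}$, $y\in\{\beta,\delta\}$, $1\leqslant i\leqslant n$: add $L_{n+1}(x)$, let $i<i_l<\dots<i_k=n+1$ be the indices of the rows of type $\alpha/\gamma$ strictly above row $i$, perform successively $L^*_{i_{k-1}}\to L_{i_k},\dots,L^*_{i_l}\to L_{i_{l+1}}$, then $L_i\to L_{i_l}$, then label $c_i$ with $y$; this is $\mathrm{insertion}(T,(x,y,i))$. -}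

module Defs where

open import Data.Nat using (ℕ; zero; suc; _+_; _∸_; _≤_; _<_; _≡ᵇ_; _<ᵇ_; _≤ᵇ_)
open import Data.Bool using (Bool; true; false; if_then_else_; _∧_)
open import Data.Maybe using (Maybe; just; nothing)
open import Data.List using (List; []; _∷_; _++_; length)
open import Data.Product using (∃)
open import Data.Sum using (_⊎_)
open import Relation.Binary.PropositionalEquality using (_≡_)

data Label : Set where
  α β γ δ : Label

data Mark : Set where
  ● ○ : Mark

markOf : Label → Mark
markOf α = ●
markOf δ = ●
markOf β = ○
markOf γ = ○

countCirc : List Mark → ℕ
countCirc []       = 0
countCirc (● ∷ m)  = countCirc m
countCirc (○ ∷ m)  = suc (countCirc m)

-- Fillings: T i j is the content of cell (i,j) (row i, column j, 1-based).
-- Only the cells 1 ≤ j ≤ i ≤ n of the staircase of size n are relevant;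
-- values outside the shape are never read.

Filling : Set
Filling = ℕ → ℕ → Maybe Label

record IsStaircase (n : ℕ) (T : Filling) : Set where
  field
    diag    : ∀ i → 1 ≤ i → i ≤ n → ∃ λ x → T i i ≡ just x
    colCond : ∀ i j i' → 1 ≤ j → j ≤ i → i < i' → i' ≤ n →
              (T i j ≡ just α ⊎ T i j ≡ just γ) → T i' j ≡ nothing
    rowCond : ∀ i j j' → 1 ≤ j' → j' < j → j ≤ i → i ≤ n →
              (T i j ≡ just β ⊎ T i j ≡ just δ) → T i j' ≡ nothing

-- Monomials α^a β^b γ^c δ^d q^e in ℤ[α,β,γ,δ,q] (coefficient 1),
-- represented by their exponent vectors; product = sum of exponents.

record Mono : Set where
  constructor mono
  field
    eα eβ eγ eδ eq : ℕ

one : Mono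
one = mono 0 0 0 0 0

infixl 7 _·_
_·_ : Mono → Mono → Mono
mono a b c d e · mono a' b' c' d' e' = mono (a + a') (b + b') (c + c') (d + d') (e + e')

lab : Label → Mono
lab α = mono 1 0 0 0 0
lab β = mono 0 1 0 0 0
lab γ = mono 0 0 1 0 0
lab δ = mono 0 0 0 1 0

qPow : ℕ → Mono
qPow k = mono 0 0 0 0 k

scanUp : (ℕ → Maybe Label) → ℕ → ℕ → Maybe Label
scanUp f lo zero = nothing
scanUp f lo (suc c) with f lo
... | just x  = just x
... | nothing = scanUp f (suc lo) c

scanDown : (ℕ → Maybe Label) → ℕ → ℕ → Maybe Label
scanDown f hi zero = nothing
scanDown f hi (suc c) with f hi
... | just x  = just x
... | nothing = scanDown f (hi ∸ 1) c

-- r(e): nearest labelled cell to the right of (i,j) in row i (columns j+1..i)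
rightOf : Filling → ℕ → ℕ → Maybe Label
rightOf T i j = scanUp (λ k → T i k) (suc j) (i ∸ j)

-- b(e): nearest labelled cell below (i,j) in column j (rows i-1 down to j)
belowOf : Filling → ℕ → ℕ → Maybe Label
belowOf T i j = scanDown (λ k → T k j) (i ∸ 1) (i ∸ j)

-- exponent of q contributed by an empty cell, given r(e) and b(e)
qCell : Maybe Label → Maybe Label → ℕ
qCell (just δ) _        = 1
qCell (just α) (just β) = 1
qCell (just α) (just γ) = 1
qCell (just γ) (just β) = 1
qCell (just γ) (just γ) = 1
qCell _        _        = 0

cellWeight : Filling → ℕ → ℕ → Mono
cellWeight T i j with T i j
... | just x  = lab x
... | nothing = qPow (qCell (rightOf T i j) (belowOf T i j))

prodRange : (ℕ → Mono) → ℕ → Mono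
prodRange f zero    = one
prodRange f (suc k) = prodRange f k · f (suc k)

weight : ℕ → Filling → Mono
weight n T = prodRange (λ i → prodRange (λ j → cellWeight T i j) i) n

-- Type: m_n ⋯ m_1 (leftmost letter = row n)

diagMark : Maybe Label → Mark
diagMark (just x) = markOf x
diagMark nothing  = ○   -- never used for staircase tableaux

typeOf : ℕ → Filling → List Mark
typeOf zero    T = []
typeOf (suc k) T = diagMark (T (suc k) (suc k)) ∷ typeOf k T

-- L_{i1} → L_{i2}: move (i1,k) to (i2,k) for 1 ≤ k ≤ i1, emptying (i1,k)
moveRow : ℕ → ℕ → Filling → Filling
moveRow i1 i2 T i j =
  if (1 ≤ᵇ j) ∧ (j ≤ᵇ i1)
  then (if i ≡ᵇ i2 then T i1 j else if i ≡ᵇ i1 then nothing else T i j)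
  else T i j

-- L*_{i1} → L_{i2}: same for 1 ≤ k < i1
moveRowStar : ℕ → ℕ → Filling → Filling
moveRowStar i1 i2 T i j =
  if (1 ≤ᵇ j) ∧ (j <ᵇ i1)
  then (if i ≡ᵇ i2 then T i1 j else if i ≡ᵇ i1 then nothing else T i j)
  else T i j

addRow : ℕ → Label → Filling → Filling
addRow n z T i j =
  if i ≡ᵇ suc n then (if j ≡ᵇ suc n then just z else nothing) else T i j

setDiag : ℕ → Label → Filling → Filling
setDiag k y T i j = if (i ≡ᵇ k) ∧ (j ≡ᵇ k) then just y else T i j

isAC : Maybe Label → Bool
isAC (just α) = true
isAC (just γ) = true
isAC _        = false

acRows : Filling → ℕ → ℕ → List ℕ
acRows T zero    lo = []
acRows T (suc r) lo =
  if isAC (T (suc r) (suc r)) ∧ (lo <ᵇ suc r)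
  then suc r ∷ acRows T r lo
  else acRows T r lo

-- given [i_k, i_{k-1}, ..., i_l] (decreasing), perform successively
-- L*_{i_{k-1}} → L_{i_k}, ..., L*_{i_l} → L_{i_{l+1}}
shiftChain : List ℕ → Filling → Filling
shiftChain (a ∷ b ∷ rest) T = shiftChain (b ∷ rest) (moveRowStar b a T)
shiftChain _              T = T

lastOr : ℕ → List ℕ → ℕ
lastOr d []       = d
lastOr d (x ∷ xs) = lastOr x xs

-- insertion(T, y), y ∈ {β, δ}
insertBD : ℕ → Label → Filling → Filling
insertBD n y T = addRow n y T

-- insertion(T, x), x ∈ {α, γ}
insertAC : ℕ → Label → Filling → Filling
insertAC n x T = let T' = addRow n x T in shiftChain (acRows T' (suc n) 0) T'

insertXYI : ℕ → Label → Label → ℕ → Filling → Filling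
insertXYI n x y i T =
  let T'  = addRow n x T
      rs  = acRows T' (suc n) i
      T'' = shiftChain rs T'
  in setDiag i y (moveRow i (lastOr (suc n) rs) T'')

-- The weight is a product of row weights.  Inserting y ∈ {β, δ}
-- only adds the row L_{n+1}(y), whose n empty cells all see y to their
-- right: they contribute q^0 resp. q^n.  For x ∈ {α, γ} let G be T with
-- L_{n+1}(x) added.  Both insertion(T, x) and insertion(T, (x, y, i)) turn
-- G into a tableau F of the same shape (record 'Shifted', with lo = 0 resp.
-- lo = i): every α/γ row r above lo receives the prefix of the previous
-- α/γ row p = prevAC G lo r (or of row lo) and is empty between that prefix
-- and its diagonal, while all other rows above lo are unchanged.
-- A copied cell weighs exactly as the original one: its lower neighbour is
-- the same, and its right neighbour is the same up to exchanging α and γ.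
-- A new empty cell (r, j) sees c_r ∈ {α, γ} to its right and c_j below,
-- so it contributes q iff c_j has type ○.  Telescoping over the rows
-- ('ShiftedWeight.partial') gives weight F = (rows 1 … lo of F)
-- · (rows lo … n of G) · q^{#○ on the diagonal above lo} · x.  The instances lo = 0 and lo = i
-- (where row i keeps only its new label y, contributing q^{(i-1)[y = δ]})
-- yield the formulas; the type is read off the unchanged diagonal.
module Submission where

open import Defs
open import Data.Nat using (ℕ; zero; suc; _+_; _∸_; _≤_; _<_; _≡ᵇ_; _<ᵇ_; _≤ᵇ_; z≤n; s≤s; _⊔_; _*_; s≤s⁻¹)
open import Data.Nat.Properties
open import Data.Bool using (true; false; if_then_else_; _∧_; T)
open import Data.Bool.Properties using (∧-zeroʳ)
open import Data.Maybe using (Maybe; just; nothing)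
open import Data.List using (_∷_; _++_; length; take; drop)
open import Data.List.Properties using (length-drop; take++drop≡id)
open import Data.Product using (_×_; _,_; ∃; proj₂)
open import Data.Sum using (_⊎_; inj₁; inj₂)
open import Data.Empty using (⊥; ⊥-elim)
open import Relation.Nullary using (¬_; yes; no)
open import Relation.Binary.PropositionalEquality
open import Relation.Binary.Definitions using (tri<; tri≈; tri>)
open import Algebra.Bundles using (CommutativeMonoid)
open import Level using (0ℓ)

·-assoc : ∀ a b c → (a · b) · c ≡ a · (b · c)
·-assoc (mono a₁ a₂ a₃ a₄ a₅) (mono b₁ b₂ b₃ b₄ b₅) (mono c₁ c₂ c₃ c₄ c₅)
  rewrite +-assoc a₁ b₁ c₁ | +-assoc a₂ b₂ c₂ | +-assoc a₃ b₃ c₃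
        | +-assoc a₄ b₄ c₄ | +-assoc a₅ b₅ c₅ = refl

·-comm : ∀ a b → a · b ≡ b · a
·-comm (mono a₁ a₂ a₃ a₄ a₅) (mono b₁ b₂ b₃ b₄ b₅)
  rewrite +-comm a₁ b₁ | +-comm a₂ b₂ | +-comm a₃ b₃ | +-comm a₄ b₄ | +-comm a₅ b₅ = refl

·-identityˡ : ∀ a → one · a ≡ a
·-identityˡ (mono _ _ _ _ _) = refl

·-identityʳ : ∀ a → a · one ≡ a
·-identityʳ a = trans (·-comm a one) (·-identityˡ a)

monoCommutativeMonoid : CommutativeMonoid 0ℓ 0ℓ
monoCommutativeMonoid = record
  { Carrier = Mono ; _≈_ = _≡_ ; _∙_ = _·_ ; ε = one
  ; isCommutativeMonoid = record
    { isMonoid = record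
      { isSemigroup = record
        { isMagma = record { isEquivalence = isEquivalence ; ∙-cong = cong₂ _·_ }
        ; assoc = ·-assoc }
      ; identity = ·-identityˡ , ·-identityʳ }
    ; comm = ·-comm } }

open import Algebra.Solver.CommutativeMonoid monoCommutativeMonoid using (solve; _⊜_; _⊕_; id)

<ᵇ-true : ∀ m n → m < n → (m <ᵇ n) ≡ true
<ᵇ-true zero    (suc n) _       = refl
<ᵇ-true (suc m) (suc n) (s≤s p) = <ᵇ-true m n p

<ᵇ-false : ∀ m n → n ≤ m → (m <ᵇ n) ≡ false
<ᵇ-false m       zero    _       = refl
<ᵇ-false (suc m) (suc n) (s≤s p) = <ᵇ-false m n p

≤ᵇ-true : ∀ m n → m ≤ n → (m ≤ᵇ n) ≡ true
≤ᵇ-true zero    n _ = refl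
≤ᵇ-true (suc m) n p = <ᵇ-true m n p

≤ᵇ-false : ∀ m n → n < m → (m ≤ᵇ n) ≡ false
≤ᵇ-false (suc m) n (s≤s p) = <ᵇ-false m n p

≡ᵇ-true : ∀ m → (m ≡ᵇ m) ≡ true
≡ᵇ-true zero    = refl
≡ᵇ-true (suc m) = ≡ᵇ-true m

≡ᵇ-false : ∀ m n → m ≢ n → (m ≡ᵇ n) ≡ false
≡ᵇ-false zero    zero    p = ⊥-elim (p refl)
≡ᵇ-false zero    (suc n) p = refl
≡ᵇ-false (suc m) zero    p = refl
≡ᵇ-false (suc m) (suc n) p = ≡ᵇ-false m n (λ e → p (cong suc e))

<ᵇ-sound : ∀ {m n} → (m <ᵇ n) ≡ true → m < n
<ᵇ-sound {m} {n} e = <ᵇ⇒< m n (subst T (sym e) _)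

false≢true : false ≢ true
false≢true ()

-- 'a <∣> b' is the first label among a, b: scanning a row or a column
-- is a fold of _<∣>_, and the lemmas below split such scans.  (This is
-- Data.Maybe's alternative operator specialised to labels; the
-- monomorphic version keeps type checking of this file fast.)

infixr 6 _<∣>_
_<∣>_ : Maybe Label → Maybe Label → Maybe Label
just x  <∣> _ = just x
nothing <∣> m = m

<∣>-identityʳ : ∀ m → m <∣> nothing ≡ m
<∣>-identityʳ (just x) = refl
<∣>-identityʳ nothing  = refl

<∣>-assoc : ∀ a b c → (a <∣> b) <∣> c ≡ a <∣> (b <∣> c)
<∣>-assoc (just x) b c = refl
<∣>-assoc nothing  b c = refl

<∣>-just : ∀ {m z} x → m ≡ just z → m <∣> x ≡ m
<∣>-just x refl = refl

<∣>-labelled : ∀ m z → ∃ λ w → m <∣> just z ≡ just w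
<∣>-labelled (just x) z = x , refl
<∣>-labelled nothing  z = z , refl

scanUp-step : ∀ f lo c → scanUp f lo (suc c) ≡ f lo <∣> scanUp f (suc lo) c
scanUp-step f lo c with f lo
... | just x  = refl
... | nothing = refl

scanDown-step : ∀ f hi c → scanDown f hi (suc c) ≡ f hi <∣> scanDown f (hi ∸ 1) c
scanDown-step f hi c with f hi
... | just x  = refl
... | nothing = refl

scanUp-split : ∀ f lo d c → scanUp f lo (d + c) ≡ scanUp f lo d <∣> scanUp f (lo + d) c
scanUp-split f lo zero    c rewrite +-identityʳ lo = refl
scanUp-split f lo (suc d) c = begin
  scanUp f lo (suc (d + c))
    ≡⟨ scanUp-step f lo (d + c) ⟩
  f lo <∣> scanUp f (suc lo) (d + c)
    ≡⟨ cong (f lo <∣>_) (scanUp-split f (suc lo) d c) ⟩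
  f lo <∣> (scanUp f (suc lo) d <∣> scanUp f (suc lo + d) c)
    ≡⟨ sym (<∣>-assoc (f lo) _ _) ⟩
  (f lo <∣> scanUp f (suc lo) d) <∣> scanUp f (suc lo + d) c
    ≡⟨ cong (λ z → z <∣> scanUp f (suc lo + d) c) (sym (scanUp-step f lo d)) ⟩
  scanUp f lo (suc d) <∣> scanUp f (suc lo + d) c
    ≡⟨ cong (λ z → scanUp f lo (suc d) <∣> scanUp f z c) (sym (+-suc lo d)) ⟩
  scanUp f lo (suc d) <∣> scanUp f (lo + suc d) c ∎
  where open ≡-Reasoning

scanDown-split : ∀ f hi d c → scanDown f hi (d + c) ≡ scanDown f hi d <∣> scanDown f (hi ∸ d) c
scanDown-split f hi zero    c = refl
scanDown-split f hi (suc d) c = begin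
  scanDown f hi (suc (d + c))
    ≡⟨ scanDown-step f hi (d + c) ⟩
  f hi <∣> scanDown f (hi ∸ 1) (d + c)
    ≡⟨ cong (f hi <∣>_) (scanDown-split f (hi ∸ 1) d c) ⟩
  f hi <∣> (scanDown f (hi ∸ 1) d <∣> scanDown f (hi ∸ 1 ∸ d) c)
    ≡⟨ sym (<∣>-assoc (f hi) _ _) ⟩
  (f hi <∣> scanDown f (hi ∸ 1) d) <∣> scanDown f (hi ∸ 1 ∸ d) c
    ≡⟨ cong (λ z → z <∣> scanDown f (hi ∸ 1 ∸ d) c) (sym (scanDown-step f hi d)) ⟩
  scanDown f hi (suc d) <∣> scanDown f (hi ∸ 1 ∸ d) c
    ≡⟨ cong (λ z → scanDown f hi (suc d) <∣> scanDown f z c) (∸-+-assoc hi 1 d) ⟩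
  scanDown f hi (suc d) <∣> scanDown f (hi ∸ suc d) c ∎
  where open ≡-Reasoning

scanUp-ext : ∀ f g lo c → (∀ k → lo ≤ k → k < lo + c → f k ≡ g k) → scanUp f lo c ≡ scanUp g lo c
scanUp-ext f g lo zero    h = refl
scanUp-ext f g lo (suc c) h =
  trans (scanUp-step f lo c)
    (trans (cong₂ _<∣>_ (h lo ≤-refl (subst (lo <_) (sym (+-suc lo c)) (s≤s (m≤m+n lo c))))
                         (scanUp-ext f g (suc lo) c (λ k p q → h k (≤-trans (n≤1+n lo) p) (subst (k <_) (sym (+-suc lo c)) q))))
           (sym (scanUp-step g lo c)))

scanDown-ext : ∀ f g hi c → (∀ k → k ≤ hi → hi < k + c → f k ≡ g k) → scanDown f hi c ≡ scanDown g hi c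
scanDown-ext f g hi zero    h = refl
scanDown-ext f g hi (suc c) h =
  trans (scanDown-step f hi c)
    (trans (cong₂ _<∣>_ (h hi ≤-refl (subst (hi <_) (sym (+-suc hi c)) (s≤s (m≤m+n hi c))))
                         (scanDown-ext f g (hi ∸ 1) c (λ k p q → h k (≤-trans p (m∸n≤m hi 1)) (still-covered hi k c q))))
           (sym (scanDown-step g hi c)))
  where
  still-covered : ∀ hi k c → hi ∸ 1 < k + c → hi < k + suc c
  still-covered zero     k c q = subst (0 <_) (sym (+-suc k c)) (s≤s z≤n)
  still-covered (suc hi) k c q = subst (suc hi <_) (sym (+-suc k c)) (s≤s q)

scanUp-empty : ∀ f lo c → (∀ k → lo ≤ k → k < lo + c → f k ≡ nothing) → scanUp f lo c ≡ nothing
scanUp-empty f lo c h = trans (scanUp-ext f (λ _ → nothing) lo c h) (all-empty lo c)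
  where
  all-empty : ∀ lo c → scanUp (λ _ → nothing) lo c ≡ nothing
  all-empty lo zero    = refl
  all-empty lo (suc c) = all-empty (suc lo) c

scanDown-empty : ∀ f hi c → (∀ k → k ≤ hi → hi < k + c → f k ≡ nothing) → scanDown f hi c ≡ nothing
scanDown-empty f hi c h = trans (scanDown-ext f (λ _ → nothing) hi c h) (all-empty hi c)
  where
  all-empty : ∀ hi c → scanDown (λ _ → nothing) hi c ≡ nothing
  all-empty hi zero    = refl
  all-empty hi (suc c) = all-empty (hi ∸ 1) c

prodFrom : (ℕ → Mono) → ℕ → ℕ → Mono
prodFrom f a zero    = one
prodFrom f a (suc k) = f a · prodFrom f (suc a) k

sumFrom : (ℕ → ℕ) → ℕ → ℕ → ℕ
sumFrom c a zero    = 0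
sumFrom c a (suc k) = c a + sumFrom c (suc a) k

prodFrom-ext : ∀ f g a k → (∀ j → a ≤ j → j < a + k → f j ≡ g j) → prodFrom f a k ≡ prodFrom g a k
prodFrom-ext f g a zero    h = refl
prodFrom-ext f g a (suc k) h =
  cong₂ _·_ (h a ≤-refl (subst (a <_) (sym (+-suc a k)) (s≤s (m≤m+n a k))))
            (prodFrom-ext f g (suc a) k (λ j p q → h j (≤-trans (n≤1+n a) p) (subst (j <_) (sym (+-suc a k)) q)))

sumFrom-ext : ∀ f g a k → (∀ j → a ≤ j → j < a + k → f j ≡ g j) → sumFrom f a k ≡ sumFrom g a k
sumFrom-ext f g a zero    h = refl
sumFrom-ext f g a (suc k) h =
  cong₂ _+_ (h a ≤-refl (subst (a <_) (sym (+-suc a k)) (s≤s (m≤m+n a k))))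
            (sumFrom-ext f g (suc a) k (λ j p q → h j (≤-trans (n≤1+n a) p) (subst (j <_) (sym (+-suc a k)) q)))

prodFrom-split : ∀ f a k l → prodFrom f a (k + l) ≡ prodFrom f a k · prodFrom f (a + k) l
prodFrom-split f a zero    l rewrite +-identityʳ a = sym (·-identityˡ _)
prodFrom-split f a (suc k) l rewrite prodFrom-split f (suc a) k l | +-suc a k =
  sym (·-assoc (f a) (prodFrom f (suc a) k) (prodFrom f (suc (a + k)) l))

sumFrom-split : ∀ f a k l → sumFrom f a (k + l) ≡ sumFrom f a k + sumFrom f (a + k) l
sumFrom-split f a zero    l rewrite +-identityʳ a = refl
sumFrom-split f a (suc k) l rewrite sumFrom-split f (suc a) k l | +-suc a k =
  sym (+-assoc (f a) (sumFrom f (suc a) k) (sumFrom f (suc (a + k)) l))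

prodFrom-snoc : ∀ f a k → prodFrom f a (suc k) ≡ prodFrom f a k · f (a + k)
prodFrom-snoc f a k = trans (cong (prodFrom f a) (+-comm 1 k))
  (trans (prodFrom-split f a k 1) (cong (prodFrom f a k ·_) (·-identityʳ (f (a + k)))))

sumFrom-snoc : ∀ f a k → sumFrom f a (suc k) ≡ sumFrom f a k + f (a + k)
sumFrom-snoc f a k = trans (cong (sumFrom f a) (+-comm 1 k))
  (trans (sumFrom-split f a k 1) (cong (sumFrom f a k +_) (+-identityʳ (f (a + k)))))

prodFrom-qPow : ∀ c a k → prodFrom (λ j → qPow (c j)) a k ≡ qPow (sumFrom c a k)
prodFrom-qPow c a zero    = refl
prodFrom-qPow c a (suc k) rewrite prodFrom-qPow c (suc a) k = refl

sumFrom-const : ∀ c a k → sumFrom (λ _ → c) a k ≡ k * c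
sumFrom-const c a zero    = refl
sumFrom-const c a (suc k) = cong (c +_) (sumFrom-const c (suc a) k)

prodRange≡prodFrom : ∀ f k → prodRange f k ≡ prodFrom f 1 k
prodRange≡prodFrom f zero    = refl
prodRange≡prodFrom f (suc k) rewrite prodRange≡prodFrom f k = sym (prodFrom-snoc f 1 k)

∸-split : ∀ {a b c} → a ≤ b → b ≤ c → c ∸ a ≡ (b ∸ a) + (c ∸ b)
∸-split {a} {b} {c} p q =
  sym (trans (+-comm (b ∸ a) (c ∸ b)) (trans (sym (+-∸-assoc (c ∸ b) p)) (cong (_∸ a) (m∸n+n≡m q))))

sumFrom-split-at : ∀ f a b c → a ≤ b → b ≤ c → sumFrom f a (c ∸ a) ≡ sumFrom f a (b ∸ a) + sumFrom f b (c ∸ b)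
sumFrom-split-at f a b c p q =
  trans (cong (sumFrom f a) (∸-split p q))
    (trans (sumFrom-split f a (b ∸ a) (c ∸ b)) (cong (λ z → sumFrom f a (b ∸ a) + sumFrom f z (c ∸ b)) (m+[n∸m]≡n p)))

circ : Maybe Label → ℕ
circ (just β) = 1
circ (just γ) = 1
circ _        = 0

qCell-AC : ∀ m b → isAC m ≡ true → qCell m b ≡ circ b
qCell-AC (just α) (just α) _ = refl
qCell-AC (just α) (just β) _ = refl
qCell-AC (just α) (just γ) _ = refl
qCell-AC (just α) (just δ) _ = refl
qCell-AC (just α) nothing  _ = refl
qCell-AC (just γ) (just α) _ = refl
qCell-AC (just γ) (just β) _ = refl
qCell-AC (just γ) (just γ) _ = refl
qCell-AC (just γ) (just δ) _ = refl
qCell-AC (just γ) nothing  _ = refl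

qCell-BD : ∀ y b → isAC (just y) ≡ false → qCell (just y) b ≡ qCell (just y) nothing
qCell-BD β b _ = refl
qCell-BD δ b _ = refl

-- Equality of scan results up to exchanging α and γ: the weight of an
-- empty cell cannot distinguish its right neighbours up to this relation.
data _∼_ : Maybe Label → Maybe Label → Set where
  ∼refl : ∀ {m} → m ∼ m
  ∼AC   : ∀ {m m'} → isAC m ≡ true → isAC m' ≡ true → m ∼ m'

qCell-∼ : ∀ {m m'} b → m ∼ m' → qCell m b ≡ qCell m' b
qCell-∼ b ∼refl         = refl
qCell-∼ b (∼AC ac ac') = trans (qCell-AC _ b ac) (sym (qCell-AC _ b ac'))

<∣>-∼ : ∀ x {a b} → a ∼ b → (x <∣> a) ∼ (x <∣> b)
<∣>-∼ (just x) p = ∼refl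
<∣>-∼ nothing  p = p

notAC⇒BD : ∀ z → isAC (just z) ≡ false → (just z ≡ just β) ⊎ (just z ≡ just δ)
notAC⇒BD β _ = inj₁ refl
notAC⇒BD δ _ = inj₂ refl

-- prevAC G lo r: the highest row of type α/γ strictly between lo and r,
-- or lo when there is none.  In the shifted tableau, row r receives the
-- content of row prevAC G lo r.
prevAC : Filling → ℕ → ℕ → ℕ
prevAC G lo zero    = lo
prevAC G lo (suc r) = if (lo <ᵇ r) ∧ isAC (G r r) then r else prevAC G lo r

prevAC-below : ∀ G lo r → r ≤ lo → prevAC G lo r ≡ lo
prevAC-below G lo zero    p = refl
prevAC-below G lo (suc r) p rewrite <ᵇ-false lo r (≤-trans (n≤1+n r) p) =
  prevAC-below G lo r (≤-trans (n≤1+n r) p)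

prevAC-stepAC : ∀ G lo r → lo < r → isAC (G r r) ≡ true → prevAC G lo (suc r) ≡ r
prevAC-stepAC G lo r p q rewrite <ᵇ-true lo r p | q = refl

prevAC-stepBD : ∀ G lo r → isAC (G r r) ≡ false → prevAC G lo (suc r) ≡ prevAC G lo r
prevAC-stepBD G lo r q rewrite q | ∧-zeroʳ (lo <ᵇ r) = refl

prevAC-stepLow : ∀ G lo r → r ≤ lo → prevAC G lo (suc r) ≡ prevAC G lo r
prevAC-stepLow G lo r p rewrite <ᵇ-false lo r p = refl

prevAC-≥ : ∀ G lo r → lo ≤ prevAC G lo r
prevAC-≥ G lo zero    = ≤-refl
prevAC-≥ G lo (suc r) with (lo <ᵇ r) in e | isAC (G r r)
... | true  | true  = <⇒≤ (<ᵇ-sound e)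
... | true  | false = prevAC-≥ G lo r
... | false | _     = prevAC-≥ G lo r

prevAC-< : ∀ G lo r → lo < r → prevAC G lo r < r
prevAC-< G lo (suc r) p with (lo <ᵇ r) in e | isAC (G r r)
... | true  | true  = ≤-refl
... | true  | false = m<n⇒m<1+n (prevAC-< G lo r (<ᵇ-sound e))
... | false | _ with m≤n⇒m<n∨m≡n (s≤s⁻¹ p)
...   | inj₁ q    = ⊥-elim (false≢true (trans (sym e) (<ᵇ-true lo r q)))
...   | inj₂ refl = subst (_< suc lo) (sym (prevAC-below G lo lo ≤-refl)) ≤-refl

prevAC-isAC : ∀ G lo r → lo < prevAC G lo r → isAC (G (prevAC G lo r) (prevAC G lo r)) ≡ true
prevAC-isAC G lo zero    p = ⊥-elim (<-irrefl refl p)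
prevAC-isAC G lo (suc r) p with (lo <ᵇ r) | isAC (G r r) in e
... | true  | true  = e
... | true  | false = prevAC-isAC G lo r p
... | false | _     = prevAC-isAC G lo r p

prevAC-gap : ∀ G lo r k → prevAC G lo r < k → k < r → isAC (G k k) ≡ false
prevAC-gap G lo (suc r) k p q with (lo <ᵇ r) in e | isAC (G r r) in e'
... | true | true = ⊥-elim (<-irrefl refl (≤-trans q p))
... | true | false with m≤n⇒m<n∨m≡n (s≤s⁻¹ q)
...   | inj₁ k<r  = prevAC-gap G lo r k p k<r
...   | inj₂ refl = e'
prevAC-gap G lo (suc r) k p q | false | _ with m≤n⇒m<n∨m≡n (s≤s⁻¹ q)
...   | inj₁ k<r  = prevAC-gap G lo r k p k<r
...   | inj₂ refl = ⊥-elim (false≢true (trans (sym e) (<ᵇ-true lo k (≤-<-trans (prevAC-≥ G lo k) p))))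

prevAC-ext : ∀ G H lo r → (∀ k → k < r → G k k ≡ H k k) → prevAC G lo r ≡ prevAC H lo r
prevAC-ext G H lo zero    h = refl
prevAC-ext G H lo (suc r) h rewrite h r ≤-refl | prevAC-ext G H lo r (λ k p → h k (m<n⇒m<1+n p)) = refl

prevAC-unique : ∀ G lo r p → lo ≤ p → p < r → (lo < p → isAC (G p p) ≡ true) →
                (∀ k → p < k → k < r → isAC (G k k) ≡ false) → prevAC G lo r ≡ p
prevAC-unique G lo (suc r) p lo≤p p<r ac gap with m≤n⇒m<n∨m≡n (s≤s⁻¹ p<r)
... | inj₁ p<r' = trans (prevAC-stepBD G lo r (gap r p<r' ≤-refl))
                        (prevAC-unique G lo r p lo≤p p<r' ac (λ k x y → gap k x (m<n⇒m<1+n y)))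
... | inj₂ refl with m≤n⇒m<n∨m≡n lo≤p
...   | inj₁ lo<p = prevAC-stepAC G lo p lo<p (ac lo<p)
...   | inj₂ refl = trans (prevAC-stepLow G lo lo ≤-refl) (prevAC-below G lo lo ≤-refl)

-- copyEnd lo p = max (lo+1) p: in an α/γ row r above lo, the columns
-- j < copyEnd lo (prevAC G lo r) carry the copied content.
copyEnd : ℕ → ℕ → ℕ
copyEnd lo p = suc lo ⊔ p

copyEnd-≥lo : ∀ lo p → suc lo ≤ copyEnd lo p
copyEnd-≥lo lo p = m≤m⊔n (suc lo) p

copyEnd-≥p : ∀ lo p → p ≤ copyEnd lo p
copyEnd-≥p lo p = m≤n⊔m (suc lo) p

copyEnd-lo : ∀ lo → copyEnd lo lo ≡ suc lo
copyEnd-lo lo = m≥n⇒m⊔n≡m (n≤1+n lo)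

copyEnd-above : ∀ lo p → lo < p → copyEnd lo p ≡ p
copyEnd-above lo p lp = m≤n⇒m⊔n≡n lp

copyEnd-cases : ∀ lo p j → lo ≤ p → j < copyEnd lo p → (lo < p × j < p) ⊎ (p ≡ lo × j ≤ lo)
copyEnd-cases lo p j lp jc with m≤n⇒m<n∨m≡n lp
... | inj₁ lo<p = inj₁ (lo<p , subst (j <_) (copyEnd-above lo p lo<p) jc)
... | inj₂ refl = inj₂ (refl , s≤s⁻¹ (subst (j <_) (copyEnd-lo lo) jc))

record Extended (n : ℕ) (G : Filling) : Set where
  field
    diagLabelled : ∀ r → 1 ≤ r → r ≤ suc n → ∃ λ z → G r r ≡ just z
    rowBD-empty  : ∀ r j → 1 ≤ j → j < r → r ≤ suc n → isAC (G r r) ≡ false → G r j ≡ nothing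

addRow-below : ∀ n z T r j → r ≢ suc n → addRow n z T r j ≡ T r j
addRow-below n z T r j p rewrite ≡ᵇ-false r (suc n) p = refl

addRow-diag : ∀ n z T → addRow n z T (suc n) (suc n) ≡ just z
addRow-diag n z T rewrite ≡ᵇ-true n = refl

addRow-offDiag : ∀ n z T j → j ≢ suc n → addRow n z T (suc n) j ≡ nothing
addRow-offDiag n z T j p rewrite ≡ᵇ-true n | ≡ᵇ-false j (suc n) p = refl

addRow-extended : ∀ n x T → IsStaircase n T → isAC (just x) ≡ true → Extended n (addRow n x T)
addRow-extended n x T S ax = record { diagLabelled = diag′ ; rowBD-empty = rowBD }
  where
  open IsStaircase S
  diag′ : ∀ r → 1 ≤ r → r ≤ suc n → ∃ λ z → addRow n x T r r ≡ just z
  diag′ r p q with m≤n⇒m<n∨m≡n q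
  ... | inj₂ refl = x , addRow-diag n x T
  ... | inj₁ r<1+n with diag r p (s≤s⁻¹ r<1+n)
  ...   | z , e = z , trans (addRow-below n x T r r (<⇒≢ r<1+n)) e
  rowBD : ∀ r j → 1 ≤ j → j < r → r ≤ suc n → isAC (addRow n x T r r) ≡ false → addRow n x T r j ≡ nothing
  rowBD r j p q s t with m≤n⇒m<n∨m≡n s
  ... | inj₂ refl = ⊥-elim (false≢true (trans (sym t) (trans (cong isAC (addRow-diag n x T)) ax)))
  ... | inj₁ r<1+n with diag r (≤-trans p (<⇒≤ q)) (s≤s⁻¹ r<1+n)
  ...   | z , e = trans (addRow-below n x T r j (<⇒≢ r<1+n))
                        (rowCond r r j p q ≤-refl (s≤s⁻¹ r<1+n) diagBD)
    where
    diagBD : (T r r ≡ just β) ⊎ (T r r ≡ just δ)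
    diagBD with notAC⇒BD z (trans (cong isAC (trans (sym e) (sym (addRow-below n x T r r (<⇒≢ r<1+n))))) t)
    ... | inj₁ k = inj₁ (trans e k)
    ... | inj₂ k = inj₂ (trans e k)

acRows-ext : ∀ G H m lo → (∀ k → k ≤ m → G k k ≡ H k k) → acRows G m lo ≡ acRows H m lo
acRows-ext G H zero    lo h = refl
acRows-ext G H (suc m) lo h rewrite h (suc m) ≤-refl | acRows-ext G H m lo (λ k p → h k (m≤n⇒m≤1+n p)) = refl

acRows-top : ∀ n lo x T → isAC (just x) ≡ true → lo < suc n →
             acRows (addRow n x T) (suc n) lo ≡ suc n ∷ acRows (addRow n x T) n lo
acRows-top n lo x T ax p rewrite addRow-diag n x T | ax | <ᵇ-true lo (suc n) p = refl

module OneMove (G : Filling) (b a : ℕ) (b<a : b < a) where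
  H : Filling
  H = moveRowStar b a G

  H-other : ∀ r j → r ≢ a → r ≢ b → H r j ≡ G r j
  H-other r j p q with (1 ≤ᵇ j) ∧ (j <ᵇ b)
  ... | false = refl
  ... | true rewrite ≡ᵇ-false r a p | ≡ᵇ-false r b q = refl

  H-target : ∀ j → 1 ≤ j → j < b → H a j ≡ G b j
  H-target j p q rewrite ≤ᵇ-true 1 j p | <ᵇ-true j b q | ≡ᵇ-true a = refl

  H-target-right : ∀ j → b ≤ j → H a j ≡ G a j
  H-target-right j p rewrite <ᵇ-false j b p | ∧-zeroʳ (1 ≤ᵇ j) = refl

  H-source : ∀ j → 1 ≤ j → j < b → H b j ≡ nothing
  H-source j p q rewrite ≤ᵇ-true 1 j p | <ᵇ-true j b q | ≡ᵇ-false b a (<⇒≢ b<a) | ≡ᵇ-true b = refl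

  H-source-right : ∀ j → b ≤ j → H b j ≡ G b j
  H-source-right j p rewrite <ᵇ-false j b p | ∧-zeroʳ (1 ≤ᵇ j) = refl

  H-diag : ∀ k → H k k ≡ G k k
  H-diag k with k Data.Nat.≟ a | k Data.Nat.≟ b
  ... | yes refl | _        = H-target-right k (<⇒≤ b<a)
  ... | no _     | yes refl = H-source-right k ≤-refl
  ... | no p     | no q     = H-other k k p q

record ChainSpec (G : Filling) (lo a m : ℕ) (F : Filling) : Set where
  field
    unchanged   : ∀ r j → 1 ≤ j → r ≢ a → (r ≤ lo ⊎ m < r ⊎ isAC (G r r) ≡ false ⊎ r ≤ j) → F r j ≡ G r j
    copied      : ∀ r j → r ≢ a → lo < r → r ≤ m → isAC (G r r) ≡ true → lo < prevAC G lo r →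
                  1 ≤ j → j < prevAC G lo r → F r j ≡ G (prevAC G lo r) j
    emptied     : ∀ r j → 1 ≤ j → r ≢ a → lo < r → r ≤ m → isAC (G r r) ≡ true →
                  (prevAC G lo r ≡ lo ⊎ prevAC G lo r ≤ j) → j < r → F r j ≡ nothing
    top-copied  : ∀ j → lo < prevAC G lo (suc m) → 1 ≤ j → j < prevAC G lo (suc m) →
                  F a j ≡ G (prevAC G lo (suc m)) j
    top-kept    : ∀ j → 1 ≤ j → (prevAC G lo (suc m) ≡ lo ⊎ prevAC G lo (suc m) ≤ j) → F a j ≡ G a j

chainSpec-base : ∀ G lo a → ChainSpec G lo a 0 G
chainSpec-base G lo a = record
  { unchanged  = λ r j _ _ _ → refl
  ; copied     = λ r j _ lo<r r≤0 → ⊥-elim (no-row lo<r r≤0)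
  ; emptied    = λ r j _ _ lo<r r≤0 → ⊥-elim (no-row lo<r r≤0)
  ; top-copied = λ j p → ⊥-elim (<-irrefl (sym (prevAC-stepLow G lo 0 z≤n)) p)
  ; top-kept   = λ j _ _ → refl }
  where
  no-row : ∀ {r} → lo < r → r ≤ 0 → ⊥
  no-row (s≤s _) ()

chainSpec-skip : ∀ {G lo a m F} → ¬ (lo < suc m × isAC (G (suc m) (suc m)) ≡ true) →
                 ChainSpec G lo a m F → ChainSpec G lo a (suc m) F
chainSpec-skip {G} {lo} {a} {m} {F} fixed S = record
  { unchanged  = unchanged′ ; copied = copied′ ; emptied = emptied′
  ; top-copied = λ j → subst (λ p → lo < p → 1 ≤ j → j < p → F a j ≡ G p j) (sym same-prev) (top-copied j)
  ; top-kept   = λ j → subst (λ p → 1 ≤ j → (p ≡ lo ⊎ p ≤ j) → F a j ≡ G a j) (sym same-prev) (top-kept j) }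
  where
  open ChainSpec S
  b = suc m
  same-prev : prevAC G lo (suc b) ≡ prevAC G lo b
  same-prev = by-type (isAC (G b b)) refl
    where
    by-type : ∀ t → isAC (G b b) ≡ t → prevAC G lo (suc b) ≡ prevAC G lo b
    by-type false e = prevAC-stepBD G lo b e
    by-type true  e with lo <? b
    ... | yes lo<b = ⊥-elim (fixed (lo<b , e))
    ... | no  lo≮b = prevAC-stepLow G lo b (≮⇒≥ lo≮b)
  unchanged′ : ∀ r j → 1 ≤ j → r ≢ a → (r ≤ lo ⊎ b < r ⊎ isAC (G r r) ≡ false ⊎ r ≤ j) → F r j ≡ G r j
  unchanged′ r j p q (inj₁ x)                = unchanged r j p q (inj₁ x)
  unchanged′ r j p q (inj₂ (inj₁ x))         = unchanged r j p q (inj₂ (inj₁ (<⇒≤ x)))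
  unchanged′ r j p q (inj₂ (inj₂ x))         = unchanged r j p q (inj₂ (inj₂ x))
  copied′ : ∀ r j → r ≢ a → lo < r → r ≤ b → isAC (G r r) ≡ true → lo < prevAC G lo r →
            1 ≤ j → j < prevAC G lo r → F r j ≡ G (prevAC G lo r) j
  copied′ r j q lr rb ac with m≤n⇒m<n∨m≡n rb
  ... | inj₂ refl = ⊥-elim (fixed (lr , ac))
  ... | inj₁ r<b  = copied r j q lr (s≤s⁻¹ r<b) ac
  emptied′ : ∀ r j → 1 ≤ j → r ≢ a → lo < r → r ≤ b → isAC (G r r) ≡ true →
             (prevAC G lo r ≡ lo ⊎ prevAC G lo r ≤ j) → j < r → F r j ≡ nothing
  emptied′ r j p q lr rb ac with m≤n⇒m<n∨m≡n rb
  ... | inj₂ refl = ⊥-elim (fixed (lr , ac))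
  ... | inj₁ r<b  = emptied r j p q lr (s≤s⁻¹ r<b) ac

-- The first operation L*_b → L_a of the chain, with b = m+1 an α/γ row
-- above lo: the rest of the chain acts on H = moveRowStar b a G with top
-- row b, and row a keeps the prefix of row b that was moved into it.
chainSpec-move : ∀ G lo a m → suc m < a → lo < suc m → isAC (G (suc m) (suc m)) ≡ true →
                 let H = moveRowStar (suc m) a G in
                 ChainSpec H lo (suc m) m (shiftChain (suc m ∷ acRows G m lo) H) →
                 ChainSpec G lo a (suc m) (shiftChain (suc m ∷ acRows G m lo) H)
chainSpec-move G lo a m b<a lo<b acb S = record
  { unchanged = unchanged′ ; copied = copied′ ; emptied = emptied′
  ; top-copied = top-copied′ ; top-kept = top-kept′ }
  where
  b = suc m
  open OneMove G b a b<a
  module I = ChainSpec S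
  F = shiftChain (b ∷ acRows G m lo) H
  same-prev : ∀ r → prevAC H lo r ≡ prevAC G lo r
  same-prev r = prevAC-ext H G lo r (λ k _ → H-diag k)
  prev-b : prevAC G lo (suc b) ≡ b
  prev-b = prevAC-stepAC G lo b lo<b acb
  a≢b : a ≢ b
  a≢b = >⇒≢ b<a
  top-copied′ : ∀ j → lo < prevAC G lo (suc b) → 1 ≤ j → j < prevAC G lo (suc b) → F a j ≡ G (prevAC G lo (suc b)) j
  top-copied′ j _ p q rewrite prev-b = trans (I.unchanged a j p a≢b (inj₂ (inj₁ (<⇒≤ b<a)))) (H-target j p q)
  top-kept′ : ∀ j → 1 ≤ j → (prevAC G lo (suc b) ≡ lo ⊎ prevAC G lo (suc b) ≤ j) → F a j ≡ G a j
  top-kept′ j p c rewrite prev-b with c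
  ... | inj₁ e   = ⊥-elim (<⇒≢ lo<b (sym e))
  ... | inj₂ b≤j = trans (I.unchanged a j p a≢b (inj₂ (inj₁ (<⇒≤ b<a)))) (H-target-right j b≤j)
  unchanged′ : ∀ r j → 1 ≤ j → r ≢ a → (r ≤ lo ⊎ b < r ⊎ isAC (G r r) ≡ false ⊎ r ≤ j) → F r j ≡ G r j
  unchanged′ r j p q c with r Data.Nat.≟ b
  unchanged′ r j p q (inj₁ x)                 | yes refl = ⊥-elim (<-irrefl refl (≤-<-trans x lo<b))
  unchanged′ r j p q (inj₂ (inj₁ x))          | yes refl = ⊥-elim (<-irrefl refl x)
  unchanged′ r j p q (inj₂ (inj₂ (inj₁ x)))   | yes refl = ⊥-elim (false≢true (trans (sym x) acb))
  unchanged′ r j p q (inj₂ (inj₂ (inj₂ x)))   | yes refl =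
    trans (I.top-kept j p (inj₂ (≤-trans (<⇒≤ (subst (_< b) (sym (same-prev b)) (prevAC-< G lo b lo<b))) x)))
          (H-source-right j x)
  ... | no r≢b = trans (I.unchanged r j p r≢b (below-b c)) (H-other r j q r≢b)
    where
    below-b : (r ≤ lo ⊎ b < r ⊎ isAC (G r r) ≡ false ⊎ r ≤ j) → r ≤ lo ⊎ m < r ⊎ isAC (H r r) ≡ false ⊎ r ≤ j
    below-b (inj₁ x)                = inj₁ x
    below-b (inj₂ (inj₁ x))         = inj₂ (inj₁ (<⇒≤ x))
    below-b (inj₂ (inj₂ (inj₁ x)))  = inj₂ (inj₂ (inj₁ (trans (cong isAC (H-diag r)) x)))
    below-b (inj₂ (inj₂ (inj₂ x)))  = inj₂ (inj₂ (inj₂ x))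
  copied′ : ∀ r j → r ≢ a → lo < r → r ≤ b → isAC (G r r) ≡ true → lo < prevAC G lo r →
            1 ≤ j → j < prevAC G lo r → F r j ≡ G (prevAC G lo r) j
  copied′ r j q lr rb ac lp p jp with m≤n⇒m<n∨m≡n rb
  ... | inj₂ refl =
    trans (subst (λ z → F b j ≡ H z j) (same-prev b)
                 (I.top-copied j (subst (lo <_) (sym (same-prev b)) lp) p (subst (j <_) (sym (same-prev b)) jp)))
          (H-other (prevAC G lo b) j (<⇒≢ (<-trans (prevAC-< G lo b lo<b) b<a)) (<⇒≢ (prevAC-< G lo b lo<b)))
  ... | inj₁ r<b =
    trans (subst (λ z → F r j ≡ H z j) (same-prev r)
                 (I.copied r j (<⇒≢ r<b) lr (s≤s⁻¹ r<b) (trans (cong isAC (H-diag r)) ac)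
                           (subst (lo <_) (sym (same-prev r)) lp) p (subst (j <_) (sym (same-prev r)) jp)))
          (H-other (prevAC G lo r) j (<⇒≢ (<-trans (<-trans (prevAC-< G lo r lr) r<b) b<a))
                                     (<⇒≢ (<-trans (prevAC-< G lo r lr) r<b)))
  emptied′ : ∀ r j → 1 ≤ j → r ≢ a → lo < r → r ≤ b → isAC (G r r) ≡ true →
             (prevAC G lo r ≡ lo ⊎ prevAC G lo r ≤ j) → j < r → F r j ≡ nothing
  emptied′ r j p q lr rb ac c jr with m≤n⇒m<n∨m≡n rb
  ... | inj₂ refl = trans (I.top-kept j p (subst (λ z → z ≡ lo ⊎ z ≤ j) (sym (same-prev b)) c)) (H-source j p jr)
  ... | inj₁ r<b  = I.emptied r j p (<⇒≢ r<b) lr (s≤s⁻¹ r<b) (trans (cong isAC (H-diag r)) ac)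
                              (subst (λ z → z ≡ lo ⊎ z ≤ j) (sym (same-prev r)) c) jr

chainSpec : ∀ m a G lo → m < a → ChainSpec G lo a m (shiftChain (a ∷ acRows G m lo) G)
chainSpec zero    a G lo m<a = chainSpec-base G lo a
chainSpec (suc m) a G lo m<a with isAC (G (suc m) (suc m)) in eA | lo <ᵇ suc m in eL
... | true | true =
  chainSpec-move G lo a m m<a (<ᵇ-sound eL) eA
    (subst (λ rs → ChainSpec H lo (suc m) m (shiftChain (suc m ∷ rs) H))
           (acRows-ext H G m lo (λ k _ → H-diag k))
           (chainSpec m (suc m) H lo ≤-refl))
  where open OneMove G (suc m) a m<a
... | true  | false = chainSpec-skip (λ (lo<b , _) → false≢true (trans (sym eL) (<ᵇ-true lo (suc m) lo<b)))
                                     (chainSpec m a G lo (<⇒≤ m<a))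
... | false | _     = chainSpec-skip (λ (_ , ac) → false≢true (trans (sym eA) ac))
                                     (chainSpec m a G lo (<⇒≤ m<a))

scanDown-skip : ∀ f p r' c → p ≤ r' → (∀ k → p < k → k ≤ r' → f k ≡ nothing) →
                scanDown f r' ((r' ∸ p) + c) ≡ scanDown f p c
scanDown-skip f p r' c p≤r' h =
  trans (scanDown-split f r' (r' ∸ p) c)
    (cong₂ _<∣>_ (scanDown-empty f r' (r' ∸ p) (λ k k≤r' lt → h k (above-p k lt) k≤r'))
                  (cong (λ z → scanDown f z c) (m∸[m∸n]≡n p≤r')))
  where
  above-p : ∀ k → r' < k + (r' ∸ p) → p < k
  above-p k lt with p <? k
  ... | yes x = x
  ... | no x  = ⊥-elim (<-irrefl refl (<-≤-trans lt
                  (subst (k + (r' ∸ p) ≤_) (m+[n∸m]≡n p≤r') (+-monoˡ-≤ (r' ∸ p) (≮⇒≥ x)))))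

belowOf-skip : ∀ H r j s → j ≤ s → s < r → (∀ k → s < k → k < r → H k j ≡ nothing) →
               belowOf H r j ≡ H s j <∣> belowOf H s j
belowOf-skip H (suc r') j s js sr h =
  trans (cong (scanDown (λ k → H k j) r') count)
    (trans (scanDown-skip (λ k → H k j) s r' (suc (s ∸ j)) (s≤s⁻¹ sr) (λ k a b → h k a (s≤s b)))
           (scanDown-step (λ k → H k j) s (s ∸ j)))
  where
  count : suc r' ∸ j ≡ (r' ∸ s) + suc (s ∸ j)
  count = trans (∸-split {j} {suc s} {suc r'} (m≤n⇒m≤1+n js) sr)
                (trans (+-comm (suc s ∸ j) (r' ∸ s)) (cong ((r' ∸ s) +_) (+-∸-assoc 1 js)))

belowOf-ext : ∀ H H' r j → (∀ k → j ≤ k → k < r → H k j ≡ H' k j) → belowOf H r j ≡ belowOf H' r j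
belowOf-ext H H' zero     j h rewrite 0∸n≡0 j = refl
belowOf-ext H H' (suc r') j h = scanDown-ext _ _ r' (suc r' ∸ j) (λ k a b → h k (at-least-j k a b) (s≤s a))
  where
  at-least-j : ∀ k → k ≤ r' → r' < k + (suc r' ∸ j) → j ≤ k
  at-least-j k a lt with j ≤? k
  ... | yes x = x
  ... | no x  = ⊥-elim (<-irrefl refl (<-≤-trans lt
                  (subst (k + (suc r' ∸ j) ≤_) (m+[n∸m]≡n a) (+-monoʳ-≤ k (∸-monoʳ-≤ (suc r') (≰⇒> x))))))

rightOf-split : ∀ H r j s → j < s → s ≤ r →
                rightOf H r j ≡ scanUp (H r) (suc j) (s ∸ suc j) <∣> scanUp (H r) s (suc r ∸ s)
rightOf-split H r j s js sr =
  trans (cong (scanUp (H r) (suc j)) (∸-split {suc j} {s} {suc r} js (m≤n⇒m≤1+n sr)))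
    (trans (scanUp-split (H r) (suc j) (s ∸ suc j) (suc r ∸ s))
           (cong (λ z → scanUp (H r) (suc j) (s ∸ suc j) <∣> scanUp (H r) z (suc r ∸ s)) (m+[n∸m]≡n js)))

scanUp-lastCell : ∀ f s r → s ≤ r → (∀ k → s ≤ k → k < r → f k ≡ nothing) → scanUp f s (suc r ∸ s) ≡ f r
scanUp-lastCell f s r sr h =
  trans (cong (scanUp f s) (trans (+-∸-assoc 1 sr) (+-comm 1 (r ∸ s))))
    (trans (scanUp-split f s (r ∸ s) 1)
      (trans (cong₂ _<∣>_ (scanUp-empty f s (r ∸ s) (λ k a b → h k a (subst (k <_) (m+[n∸m]≡n sr) b)))
                           (cong (λ z → scanUp f z 1) (m+[n∸m]≡n sr)))
             (trans (scanUp-step f r 0) (<∣>-identityʳ (f r)))))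

cellWeightOf : Maybe Label → Maybe Label → Maybe Label → Mono
cellWeightOf (just x) _ _ = lab x
cellWeightOf nothing  r b = qPow (qCell r b)

cellWeight-unfold : ∀ H i j → cellWeight H i j ≡ cellWeightOf (H i j) (rightOf H i j) (belowOf H i j)
cellWeight-unfold H i j with H i j
... | just x  = refl
... | nothing = refl

cellWeightOf-cong : ∀ {a a' R B R' B'} → a ≡ a' → (a' ≡ nothing → qCell R B ≡ qCell R' B') →
                    cellWeightOf a R B ≡ cellWeightOf a' R' B'
cellWeightOf-cong {just x}  refl h = refl
cellWeightOf-cong {nothing} refl h = cong qPow (h refl)

rowWeight : Filling → ℕ → Mono
rowWeight H r = prodRange (λ j → cellWeight H r j) r

-- A row whose only label is a β/δ on its diagonal: each of its r-1 empty
-- cells sees that label to its right.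
rowWeight-BD : ∀ H r y → 1 ≤ r → (∀ j → 1 ≤ j → j < r → H r j ≡ nothing) → H r r ≡ just y →
               isAC (just y) ≡ false → rowWeight H r ≡ qPow ((r ∸ 1) * qCell (just y) nothing) · lab y
rowWeight-BD H (suc R) y _ empty diag bd =
  trans (prodRange≡prodFrom _ (suc R)) (trans (prodFrom-snoc _ 1 R)
    (cong₂ _·_ (trans (prodFrom-ext _ _ 1 R empty-cell) (trans (prodFrom-qPow _ 1 R) (cong qPow (sumFrom-const _ 1 R))))
               (trans (cellWeight-unfold H (suc R) (suc R))
                      (cong (λ w → cellWeightOf w (rightOf H (suc R) (suc R)) (belowOf H (suc R) (suc R))) diag))))
  where
  empty-cell : ∀ j → 1 ≤ j → j < 1 + R → cellWeight H (suc R) j ≡ qPow (qCell (just y) nothing)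
  empty-cell j a b =
    trans (cellWeight-unfold H (suc R) j)
      (trans (cong (λ w → cellWeightOf w (rightOf H (suc R) j) (belowOf H (suc R) j)) (empty j a b))
        (cong qPow (trans (cong (λ w → qCell w (belowOf H (suc R) j))
                                 (trans (scanUp-lastCell (H (suc R)) (suc j) (suc R) b
                                                         (λ k a' b' → empty k (≤-trans (s≤s z≤n) a') b'))
                                        diag))
                          (qCell-BD y _ bd))))

cellWeight-ext : ∀ H H' r j → (∀ k l → 1 ≤ l → l ≤ k → k ≤ r → H k l ≡ H' k l) → 1 ≤ j → j ≤ r →
                 cellWeight H r j ≡ cellWeight H' r j
cellWeight-ext H H' r j h j1 jr =
  trans (cellWeight-unfold H r j)
    (trans (cellWeightOf-cong (h r j j1 jr ≤-refl) (λ _ → cong₂ qCell same-right same-below))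
           (sym (cellWeight-unfold H' r j)))
  where
  same-right : rightOf H r j ≡ rightOf H' r j
  same-right = scanUp-ext (H r) (H' r) (suc j) (r ∸ j)
    (λ k a b → h r k (≤-trans (s≤s z≤n) a) (s≤s⁻¹ (subst (k <_) (cong suc (m+[n∸m]≡n jr)) b)) ≤-refl)
  same-below : belowOf H r j ≡ belowOf H' r j
  same-below = belowOf-ext H H' r j (λ k a b → h k j j1 a (<⇒≤ b))

rowWeight-ext : ∀ H H' r → (∀ k l → 1 ≤ l → l ≤ k → k ≤ r → H k l ≡ H' k l) → rowWeight H r ≡ rowWeight H' r
rowWeight-ext H H' r h =
  trans (prodRange≡prodFrom _ r)
    (trans (prodFrom-ext _ _ 1 r (λ j a b → cellWeight-ext H H' r j h a (s≤s⁻¹ b))) (sym (prodRange≡prodFrom _ r)))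

weight-ext : ∀ H H' R → (∀ k l → 1 ≤ l → l ≤ k → k ≤ R → H k l ≡ H' k l) → weight R H ≡ weight R H'
weight-ext H H' zero    h = refl
weight-ext H H' (suc R) h =
  cong₂ _·_ (weight-ext H H' R (λ k l a b c → h k l a b (m≤n⇒m≤1+n c))) (rowWeight-ext H H' (suc R) h)

-- The result F of inserting into the extended tableau G above row lo
-- (lo = 0 for insertion(T, x), lo = i for insertion(T, (x, y, i))),
-- described row by row: rows below lo and rows of type β/δ above lo are
-- unchanged, row lo is empty left of its diagonal, and each α/γ row r
-- above lo keeps its diagonal, receives the columns j < copyEnd lo p of
-- row p = prevAC G lo r and is empty in between.
record Shifted (n lo : ℕ) (G F : Filling) : Set where
  field
    extended      : Extended n G
    lo≤n          : lo ≤ n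
    below-lo      : ∀ r j → 1 ≤ j → j ≤ r → r < lo → F r j ≡ G r j
    row-lo-empty  : ∀ j → 1 ≤ j → j < lo → F lo j ≡ nothing
    BD-unchanged  : ∀ r j → 1 ≤ j → j ≤ r → lo < r → r ≤ suc n → isAC (G r r) ≡ false → F r j ≡ G r j
    AC-copied     : ∀ r j → 1 ≤ j → lo < r → r ≤ suc n → isAC (G r r) ≡ true →
                    j < copyEnd lo (prevAC G lo r) → F r j ≡ G (prevAC G lo r) j
    AC-gap        : ∀ r j → lo < r → r ≤ suc n → isAC (G r r) ≡ true →
                    copyEnd lo (prevAC G lo r) ≤ j → j < r → F r j ≡ nothing
    AC-diag       : ∀ r → lo < r → r ≤ suc n → isAC (G r r) ≡ true → F r r ≡ G r r

isAC? : ∀ m → (isAC m ≡ true) ⊎ (isAC m ≡ false)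
isAC? m with isAC m
... | true  = inj₁ refl
... | false = inj₂ refl

rowWeight-diag : ∀ H r z → 1 ≤ r → H r r ≡ just z → rowWeight H r ≡ prodFrom (cellWeight H r) 1 (r ∸ 1) · lab z
rowWeight-diag H (suc R) z _ diag =
  trans (prodRange≡prodFrom _ (suc R)) (trans (prodFrom-snoc _ 1 R)
    (cong (prodFrom (cellWeight H (suc R)) 1 R ·_)
          (trans (cellWeight-unfold H (suc R) (suc R))
                 (cong (λ w → cellWeightOf w (rightOf H (suc R) (suc R)) (belowOf H (suc R) (suc R))) diag))))

module ShiftedCells (n lo : ℕ) (G F : Filling) (sh : Shifted n lo G F) where
  open Shifted sh
  open Extended extended

  F-diag : ∀ j → lo < j → j ≤ suc n → F j j ≡ G j j
  F-diag j a b with isAC? (G j j)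
  ... | inj₁ ac = AC-diag j a b ac
  ... | inj₂ bd = BD-unchanged j j (≤-trans (s≤s z≤n) a) ≤-refl a b bd

  G-between : ∀ r j k → 1 ≤ j → r ≤ suc n → prevAC G lo r < k → k < r → j < k → G k j ≡ nothing
  G-between r j k j1 rn pk kr jk = rowBD-empty k j j1 jk (≤-trans (<⇒≤ kr) rn) (prevAC-gap G lo r k pk kr)

  F-between : ∀ r j k → 1 ≤ j → r ≤ suc n → prevAC G lo r < k → k < r → j < k → F k j ≡ nothing
  F-between r j k j1 rn pk kr jk =
    trans (BD-unchanged k j j1 (<⇒≤ jk) (≤-<-trans (prevAC-≥ G lo r) pk) (≤-trans (<⇒≤ kr) rn) (prevAC-gap G lo r k pk kr))
          (G-between r j k j1 rn pk kr jk)

  below-gap : ∀ r j → lo < r → r ≤ suc n → 1 ≤ j → j < r → prevAC G lo r ≤ j → lo < j → belowOf F r j ≡ G j j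
  below-gap r j lr rn j1 jr pj lj =
    trans (belowOf-skip F r j j ≤-refl jr (λ k a b → F-between r j k j1 rn (≤-<-trans pj a) b a))
      (trans (cong (λ z → z <∣> belowOf F j j) (F-diag j lj jn))
             (<∣>-just _ (proj₂ (diagLabelled j j1 jn))))
    where jn = ≤-trans (<⇒≤ jr) rn

  below-from-prev : ∀ r j → lo < r → r ≤ suc n → 1 ≤ j → j < prevAC G lo r →
                    belowOf F r j ≡ F (prevAC G lo r) j <∣> belowOf F (prevAC G lo r) j
  below-from-prev r j lr rn j1 jp =
    belowOf-skip F r j (prevAC G lo r) (<⇒≤ jp) (prevAC-< G lo r lr) (λ k a b → F-between r j k j1 rn a b (<-trans jp a))

  below-copied-lo : ∀ j → 1 ≤ j → j < lo → F lo j <∣> belowOf F lo j ≡ belowOf G lo j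
  below-copied-lo j j1 j<lo =
    trans (cong (λ z → z <∣> belowOf F lo j) (row-lo-empty j j1 j<lo))
          (belowOf-ext F G lo j (λ k a b → below-lo k j j1 a b))

  below-copied-gap : ∀ p j → lo < p → p ≤ suc n → isAC (G p p) ≡ true → 1 ≤ j → j < p →
                     copyEnd lo (prevAC G lo p) ≤ j → F p j <∣> belowOf F p j ≡ belowOf G p j
  below-copied-gap p j lo<p pn acp j1 jp end≤j =
    trans (cong (λ z → z <∣> belowOf F p j) (AC-gap p j lo<p pn acp end≤j jp))
      (trans (below-gap p j lo<p pn j1 jp pp≤j (≤-trans (copyEnd-≥lo lo (prevAC G lo p)) end≤j))
             (sym (trans (belowOf-skip G p j j ≤-refl jp (λ k a b → G-between p j k j1 pn (≤-<-trans pp≤j a) b a))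
                         (<∣>-just _ (proj₂ (diagLabelled j j1 (≤-trans (<⇒≤ jp) pn)))))))
    where pp≤j = ≤-trans (copyEnd-≥p lo (prevAC G lo p)) end≤j

  -- below a copied cell (r, j) of an α/γ row, b(e) is the same as below
  -- the original cell (prevAC G lo r, j); by recursion along the chain of
  -- previous α/γ rows (with fuel N ≥ r)
  below-copied : ∀ N r → r ≤ N → lo < r → r ≤ suc n → isAC (G r r) ≡ true → ∀ j → 1 ≤ j →
                 j < prevAC G lo r → belowOf F r j ≡ belowOf G (prevAC G lo r) j
  below-copied N r rN lr rn ac j j1 jp with m≤n⇒m<n∨m≡n (prevAC-≥ G lo r)
  ... | inj₂ p≡lo = trans (below-from-prev r j lr rn j1 jp)
                          (subst (λ p → F p j <∣> belowOf F p j ≡ belowOf G p j) p≡lo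
                                 (below-copied-lo j j1 (subst (j <_) (sym p≡lo) jp)))
  ... | inj₁ lo<p = trans (below-from-prev r j lr rn j1 jp) (from-p N rN)
    where
    p = prevAC G lo r
    p<r = prevAC-< G lo r lr
    pn = ≤-trans (<⇒≤ p<r) rn
    acp = prevAC-isAC G lo r lo<p
    pp = prevAC G lo p
    pp<p = prevAC-< G lo p lo<p
    from-p : ∀ N → r ≤ N → F p j <∣> belowOf F p j ≡ belowOf G p j
    from-p (suc N) (s≤s rN') with j <? copyEnd lo pp
    ... | no j≮end  = below-copied-gap p j lo<p pn acp j1 jp (≮⇒≥ j≮end)
    ... | yes j<end = trans (cong (λ z → z <∣> belowOf F p j) (AC-copied p j j1 lo<p pn acp j<end))
                            (trans step (sym (belowOf-skip G p j pp j≤pp pp<p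
                                                (λ k a b → G-between p j k j1 pn a b (≤-<-trans j≤pp a)))))
      where
      j≤pp : j ≤ pp
      j≤pp with copyEnd-cases lo pp j (prevAC-≥ G lo p) j<end
      ... | inj₁ (_ , j<pp)     = <⇒≤ j<pp
      ... | inj₂ (pp≡lo , j≤lo) = subst (j ≤_) (sym pp≡lo) j≤lo
      step : (G pp j) <∣> belowOf F p j ≡ G pp j <∣> belowOf G pp j
      step with m≤n⇒m<n∨m≡n j≤pp
      ... | inj₁ j<pp = cong (G pp j <∣>_)
                             (below-copied N p (≤-trans (s≤s⁻¹ (≤-trans p<r (s≤s rN'))) ≤-refl) lo<p pn acp j j1 j<pp)
      ... | inj₂ refl = trans (<∣>-just _ (proj₂ (diagLabelled j j1 jn))) (sym (<∣>-just _ (proj₂ (diagLabelled j j1 jn))))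
        where jn = ≤-trans (<⇒≤ pp<p) pn

  -- right of a copied cell (r, j) with prevAC G lo r = lo: the copied
  -- prefix covers the columns j < lo and ends with the labelled cell c_lo,
  -- so r(e) is found inside it and equals r(e) in row lo
  right-copied-lo : ∀ r j → lo < r → r ≤ suc n → isAC (G r r) ≡ true → 1 ≤ j → j < lo →
                    prevAC G lo r ≡ lo → rightOf F r j ≡ rightOf G lo j
  right-copied-lo r j lr rn ac j1 j<lo p≡lo =
    trans (rightOf-split F r j (suc lo) (m≤n⇒m≤1+n j<lo) lr)
      (trans (cong (λ z → z <∣> scanUp (F r) (suc lo) (suc r ∸ suc lo))
                   (scanUp-ext (F r) (G lo) (suc j) (lo ∸ j)
                     (λ k a b → trans (AC-copied r k (≤-trans (s≤s z≤n) a) lr rn ac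
                                         (subst (k <_) (sym (trans (cong (copyEnd lo) p≡lo) (copyEnd-lo lo)))
                                                (subst (λ e → k < suc e) (m+[n∸m]≡n (<⇒≤ j<lo)) b)))
                                      (cong (λ w → G w k) p≡lo))))
             (<∣>-just _ (proj₂ G-right-labelled)))
    where
    G-right : rightOf G lo j ≡ scanUp (G lo) (suc j) (lo ∸ suc j) <∣> G lo lo
    G-right = trans (rightOf-split G lo j lo j<lo ≤-refl)
                    (cong (scanUp (G lo) (suc j) (lo ∸ suc j) <∣>_) (scanUp-lastCell (G lo) lo lo ≤-refl (λ k a b → ⊥-elim (<⇒≱ b a))))
    G-right-labelled : ∃ λ w → rightOf G lo j ≡ just w
    G-right-labelled with diagLabelled lo (≤-trans j1 (<⇒≤ j<lo)) (≤-trans (<⇒≤ lr) rn)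
    ... | z , e with <∣>-labelled (scanUp (G lo) (suc j) (lo ∸ suc j)) z
    ...   | w , e' = w , trans G-right (trans (cong (scanUp (G lo) (suc j) (lo ∸ suc j) <∣>_) e) e')

  -- right of a copied cell (r, j) with p = prevAC G lo r > lo: both rows
  -- agree on the prefix j < p, after which row r meets c_r and row p
  -- meets c_p, two α/γ labels
  right-copied-above : ∀ r j → lo < r → r ≤ suc n → isAC (G r r) ≡ true → 1 ≤ j → j < prevAC G lo r →
                       lo < prevAC G lo r → rightOf F r j ∼ rightOf G (prevAC G lo r) j
  right-copied-above r j lr rn ac j1 jp lo<p =
    subst₂ _∼_ (sym (trans F-split (cong (λ v → v <∣> F r r) same-prefix))) (sym G-split)
           (<∣>-∼ _ (∼AC (trans (cong isAC (AC-diag r lr rn ac)) ac) (prevAC-isAC G lo r lo<p)))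
    where
    p = prevAC G lo r
    p<r = prevAC-< G lo r lr
    end≡p = copyEnd-above lo p lo<p
    F-split : rightOf F r j ≡ scanUp (F r) (suc j) (p ∸ suc j) <∣> F r r
    F-split = trans (rightOf-split F r j p jp (<⇒≤ p<r))
                    (cong (scanUp (F r) (suc j) (p ∸ suc j) <∣>_) (scanUp-lastCell (F r) p r (<⇒≤ p<r)
                                        (λ k a b → AC-gap r k lr rn ac (subst (_≤ k) (sym end≡p) a) b)))
    G-split : rightOf G p j ≡ scanUp (G p) (suc j) (p ∸ suc j) <∣> G p p
    G-split = trans (rightOf-split G p j p jp ≤-refl)
                    (cong (scanUp (G p) (suc j) (p ∸ suc j) <∣>_) (scanUp-lastCell (G p) p p ≤-refl (λ k a b → ⊥-elim (<⇒≱ b a))))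
    same-prefix : scanUp (F r) (suc j) (p ∸ suc j) ≡ scanUp (G p) (suc j) (p ∸ suc j)
    same-prefix = scanUp-ext (F r) (G p) (suc j) (p ∸ suc j)
      (λ k a b → AC-copied r k (≤-trans (s≤s z≤n) a) lr rn ac (subst (k <_) (trans (m+[n∸m]≡n jp) (sym end≡p)) b))

  right-copied : ∀ r j → lo < r → r ≤ suc n → isAC (G r r) ≡ true → 1 ≤ j → j < prevAC G lo r →
                 rightOf F r j ∼ rightOf G (prevAC G lo r) j
  right-copied r j lr rn ac j1 jp with m≤n⇒m<n∨m≡n (prevAC-≥ G lo r)
  ... | inj₁ lo<p = right-copied-above r j lr rn ac j1 jp lo<p
  ... | inj₂ p≡lo =
    subst (λ p → rightOf F r j ∼ rightOf G p j) p≡lo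
          (subst (_∼ rightOf G lo j) (sym (right-copied-lo r j lr rn ac j1 (subst (j <_) (sym p≡lo) jp) (sym p≡lo))) ∼refl)

  cell-copied : ∀ r j → lo < r → r ≤ suc n → isAC (G r r) ≡ true → 1 ≤ j → j < copyEnd lo (prevAC G lo r) →
                cellWeight F r j ≡ cellWeight G (prevAC G lo r) j
  cell-copied r j lr rn ac j1 j<end =
    trans (cellWeight-unfold F r j)
      (trans (cellWeightOf-cong (AC-copied r j j1 lr rn ac j<end) same-q) (sym (cellWeight-unfold G p j)))
    where
    p = prevAC G lo r
    empty⇒j<p : G p j ≡ nothing → j < p
    empty⇒j<p e with copyEnd-cases lo p j (prevAC-≥ G lo r) j<end
    ... | inj₁ (_ , j<p) = j<p
    ... | inj₂ (p≡lo , j≤lo) with m≤n⇒m<n∨m≡n j≤lo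
    ...   | inj₁ j<lo = subst (j <_) (sym p≡lo) j<lo
    ...   | inj₂ refl with diagLabelled j j1 (≤-trans (<⇒≤ lr) rn)
    ...     | z , e' = ⊥-elim (just≢nothing (trans (sym e') (trans (cong (λ w → G w j) (sym p≡lo)) e)))
      where just≢nothing : ∀ {z : Label} → just z ≢ nothing
            just≢nothing ()
    same-q : G p j ≡ nothing → qCell (rightOf F r j) (belowOf F r j) ≡ qCell (rightOf G p j) (belowOf G p j)
    same-q e = trans (cong (qCell (rightOf F r j)) (below-copied r r ≤-refl lr rn ac j j1 (empty⇒j<p e)))
                     (qCell-∼ (belowOf G p j) (right-copied r j lr rn ac j1 (empty⇒j<p e)))

  -- a gap cell (r, j) sees the α/γ label of c_r to its right and c_j
  -- below, so it receives q exactly when c_j has type ○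
  cell-gap : ∀ r j → lo < r → r ≤ suc n → isAC (G r r) ≡ true → copyEnd lo (prevAC G lo r) ≤ j → j < r →
             cellWeight F r j ≡ qPow (circ (G j j))
  cell-gap r j lr rn ac end≤j jr =
    trans (cellWeight-unfold F r j)
      (trans (cellWeightOf-cong (AC-gap r j lr rn ac end≤j jr) (λ _ → refl))
        (cong qPow (trans (cong (λ z → qCell z (belowOf F r j)) right-is-diag)
          (trans (qCell-AC (G r r) (belowOf F r j) ac)
                 (cong circ (below-gap r j lr rn j1 jr (≤-trans (copyEnd-≥p lo (prevAC G lo r)) end≤j)
                                                       (≤-trans (copyEnd-≥lo lo (prevAC G lo r)) end≤j)))))))
    where
    j1 : 1 ≤ j
    j1 = ≤-trans (s≤s z≤n) (≤-trans (copyEnd-≥lo lo (prevAC G lo r)) end≤j)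
    right-is-diag : rightOf F r j ≡ G r r
    right-is-diag = trans (scanUp-lastCell (F r) (suc j) r jr (λ k a b → AC-gap r k lr rn ac (≤-trans end≤j (<⇒≤ a)) b))
                          (AC-diag r lr rn ac)

module ShiftedWeight (n lo : ℕ) (G F : Filling) (sh : Shifted n lo G F) where
  open Shifted sh
  open Extended extended
  open ShiftedCells n lo G F sh

  circDiag : ℕ → ℕ
  circDiag j = circ (G j j)

  copyEnd≤ : ∀ r → lo < r → copyEnd lo (prevAC G lo r) ≤ r
  copyEnd≤ r lr = ⊔-lub lr (<⇒≤ (prevAC-< G lo r lr))

  row-AC : ∀ r z → lo < r → r ≤ suc n → isAC (G r r) ≡ true → G r r ≡ just z →
           rowWeight F r ≡ prodFrom (cellWeight G (prevAC G lo r)) 1 (copyEnd lo (prevAC G lo r) ∸ 1)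
                            · qPow (sumFrom circDiag (copyEnd lo (prevAC G lo r)) (r ∸ copyEnd lo (prevAC G lo r)))
                            · lab z
  row-AC r z lr rn ac ez = begin
    rowWeight F r
      ≡⟨ rowWeight-diag F r z r1 (trans (AC-diag r lr rn ac) ez) ⟩
    prodFrom (cellWeight F r) 1 (r ∸ 1) · lab z
      ≡⟨ cong (λ k → prodFrom (cellWeight F r) 1 k · lab z) count ⟩
    prodFrom (cellWeight F r) 1 ((s ∸ 1) + (r ∸ s)) · lab z
      ≡⟨ cong (_· lab z) (prodFrom-split (cellWeight F r) 1 (s ∸ 1) (r ∸ s)) ⟩
    prodFrom (cellWeight F r) 1 (s ∸ 1) · prodFrom (cellWeight F r) (1 + (s ∸ 1)) (r ∸ s) · lab z
      ≡⟨ cong₂ (λ u v → u · v · lab z) copied-part (trans (cong (λ w → prodFrom (cellWeight F r) w (r ∸ s)) one+) gap-part) ⟩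
    prodFrom (cellWeight G p) 1 (s ∸ 1) · qPow (sumFrom circDiag s (r ∸ s)) · lab z ∎
    where
    open ≡-Reasoning
    p = prevAC G lo r
    s = copyEnd lo p
    r1 = ≤-trans (s≤s z≤n) lr
    one+ : 1 + (s ∸ 1) ≡ s
    one+ = m+[n∸m]≡n (≤-trans (s≤s z≤n) (copyEnd-≥lo lo p))
    count : r ∸ 1 ≡ (s ∸ 1) + (r ∸ s)
    count = ∸-split (≤-trans (s≤s z≤n) (copyEnd-≥lo lo p)) (copyEnd≤ r lr)
    copied-part : prodFrom (cellWeight F r) 1 (s ∸ 1) ≡ prodFrom (cellWeight G p) 1 (s ∸ 1)
    copied-part = prodFrom-ext _ _ 1 (s ∸ 1) (λ j a b → cell-copied r j lr rn ac a (subst (j <_) one+ b))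
    gap-part : prodFrom (cellWeight F r) s (r ∸ s) ≡ qPow (sumFrom circDiag s (r ∸ s))
    gap-part = trans (prodFrom-ext _ _ s (r ∸ s) (λ j a b → cell-gap r j lr rn ac a (subst (j <_) (m+[n∸m]≡n (copyEnd≤ r lr)) b)))
                     (prodFrom-qPow circDiag s (r ∸ s))

  -- a β/δ row above lo is unchanged (it is empty left of its diagonal)
  row-BD : ∀ r → lo < r → r ≤ suc n → isAC (G r r) ≡ false → rowWeight F r ≡ rowWeight G r
  row-BD r lr rn bd with diagLabelled r r1 rn
    where r1 = ≤-trans (s≤s z≤n) lr
  ... | y , ey =
    trans (rowWeight-BD F r y r1 (λ j a b → trans (BD-unchanged r j a (<⇒≤ b) lr rn bd) (rowBD-empty r j a b rn bd))
                        (trans (F-diag r lr rn) ey) bdy)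
          (sym (rowWeight-BD G r y r1 (λ j a b → rowBD-empty r j a b rn bd) ey bdy))
    where
    r1 = ≤-trans (s≤s z≤n) lr
    bdy = trans (cong isAC (sym ey)) bd

  -- After the rows up to R, the prefix of the
  -- last α/γ row ≤ R (row lo if none) is still 'pending': it is carried up
  -- to the next α/γ row.  Up to that pending prefix, the rows lo+1 … R of F
  -- weigh as in G, times one q per ○ on the diagonal above lo that lies
  -- below the pending prefix's end.
  pending : ℕ → Mono
  pending R = prodFrom (cellWeight G (prevAC G lo (suc R))) 1 (copyEnd lo (prevAC G lo (suc R)) ∸ 1)

  accounted : ℕ → ℕ → Mono
  accounted d R = weight lo F · prodFrom (rowWeight G) (suc lo) d · rowWeight G lo
                  · qPow (sumFrom circDiag (suc lo) (copyEnd lo (prevAC G lo (suc R)) ∸ suc lo))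

  partial-base : weight lo F · pending lo ≡ accounted 0 lo
  partial-base rewrite prevAC-stepLow G lo lo ≤-refl | prevAC-below G lo lo ≤-refl | copyEnd-lo lo | n∸n≡0 lo =
    trans (cong (weight lo F ·_) (sym (prodRange≡prodFrom (cellWeight G lo) lo)))
          (solve 2 (λ a b → a ⊕ b ⊜ ((a ⊕ id) ⊕ b) ⊕ id) refl (weight lo F) (rowWeight G lo))

  partial-stepBD : ∀ d → suc (lo + d) ≤ n → isAC (G (suc (lo + d)) (suc (lo + d))) ≡ false →
                   weight (lo + d) F · pending (lo + d) ≡ accounted d (lo + d) →
                   weight (suc (lo + d)) F · pending (suc (lo + d)) ≡ accounted (suc d) (suc (lo + d))
  partial-stepBD d rn bd IH = begin
    weight (lo + d) F · rowWeight F r · pending r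
      ≡⟨ cong₂ (λ u v → weight (lo + d) F · u · v) (row-BD r (s≤s (m≤m+n lo d)) (m≤n⇒m≤1+n rn) bd) same-pending ⟩
    weight (lo + d) F · rowWeight G r · pending (lo + d)
      ≡⟨ solve 3 (λ a b c → (a ⊕ b) ⊕ c ⊜ (a ⊕ c) ⊕ b) refl (weight (lo + d) F) (rowWeight G r) (pending (lo + d)) ⟩
    weight (lo + d) F · pending (lo + d) · rowWeight G r
      ≡⟨ cong (_· rowWeight G r) IH ⟩
    accounted d (lo + d) · rowWeight G r
      ≡⟨ solve 5 (λ a b c e f → (((a ⊕ b) ⊕ c) ⊕ e) ⊕ f ⊜ ((a ⊕ (b ⊕ f)) ⊕ c) ⊕ e) refl
               (weight lo F) (prodFrom (rowWeight G) (suc lo) d) (rowWeight G lo) (qPow E) (rowWeight G r) ⟩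
    weight lo F · (prodFrom (rowWeight G) (suc lo) d · rowWeight G r) · rowWeight G lo · qPow E
      ≡⟨ cong₂ (λ u v → weight lo F · u · rowWeight G lo · qPow (sumFrom circDiag (suc lo) (copyEnd lo v ∸ suc lo)))
               (sym (prodFrom-snoc (rowWeight G) (suc lo) d)) (sym same-prev) ⟩
    accounted (suc d) r ∎
    where
    open ≡-Reasoning
    r = suc (lo + d)
    same-prev : prevAC G lo (suc r) ≡ prevAC G lo r
    same-prev = prevAC-stepBD G lo r bd
    same-pending : pending r ≡ pending (lo + d)
    same-pending = cong (λ w → prodFrom (cellWeight G w) 1 (copyEnd lo w ∸ 1)) same-prev
    E = sumFrom circDiag (suc lo) (copyEnd lo (prevAC G lo r) ∸ suc lo)

  partial-stepAC : ∀ d z → suc (lo + d) ≤ n → isAC (G (suc (lo + d)) (suc (lo + d))) ≡ true →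
                   G (suc (lo + d)) (suc (lo + d)) ≡ just z →
                   weight (lo + d) F · pending (lo + d) ≡ accounted d (lo + d) →
                   weight (suc (lo + d)) F · pending (suc (lo + d)) ≡ accounted (suc d) (suc (lo + d))
  partial-stepAC d z rn ac ez IH = begin
    weight (lo + d) F · rowWeight F r · pending r
      ≡⟨ cong₂ (λ u v → weight (lo + d) F · u · v) (row-AC r z lr (m≤n⇒m≤1+n rn) ac ez) new-pending ⟩
    weight (lo + d) F · (pending (lo + d) · qPow g₂ · lab z) · row-r
      ≡⟨ solve 5 (λ a b c e f → (a ⊕ ((b ⊕ c) ⊕ e)) ⊕ f ⊜ (((a ⊕ b) ⊕ c) ⊕ e) ⊕ f) refl
               (weight (lo + d) F) (pending (lo + d)) (qPow g₂) (lab z) row-r ⟩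
    weight (lo + d) F · pending (lo + d) · qPow g₂ · lab z · row-r
      ≡⟨ cong (λ w → w · qPow g₂ · lab z · row-r) IH ⟩
    accounted d (lo + d) · qPow g₂ · lab z · row-r
      ≡⟨ solve 7 (λ a b c e f g h → (((((a ⊕ b) ⊕ c) ⊕ e) ⊕ f) ⊕ g) ⊕ h ⊜ ((a ⊕ (b ⊕ (h ⊕ g))) ⊕ c) ⊕ (e ⊕ f)) refl
               (weight lo F) (prodFrom (rowWeight G) (suc lo) d) (rowWeight G lo) (qPow g₁) (qPow g₂) (lab z) row-r ⟩
    weight lo F · (prodFrom (rowWeight G) (suc lo) d · (row-r · lab z)) · rowWeight G lo · qPow (g₁ + g₂)
      ≡⟨ cong₂ (λ u v → weight lo F · u · rowWeight G lo · qPow v) G-rows q-exponent ⟩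
    accounted (suc d) r ∎
    where
    open ≡-Reasoning
    r = suc (lo + d)
    lr : lo < r
    lr = s≤s (m≤m+n lo d)
    s = copyEnd lo (prevAC G lo r)
    g₁ = sumFrom circDiag (suc lo) (s ∸ suc lo)
    g₂ = sumFrom circDiag s (r ∸ s)
    row-r = prodFrom (cellWeight G r) 1 (r ∸ 1)
    end-r : copyEnd lo (prevAC G lo (suc r)) ≡ r
    end-r = trans (cong (copyEnd lo) (prevAC-stepAC G lo r lr ac)) (copyEnd-above lo r lr)
    new-pending : pending r ≡ row-r
    new-pending = trans (cong (λ w → prodFrom (cellWeight G w) 1 (copyEnd lo (prevAC G lo (suc r)) ∸ 1)) (prevAC-stepAC G lo r lr ac))
                        (cong (λ w → prodFrom (cellWeight G r) 1 (w ∸ 1)) end-r)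
    G-rows : prodFrom (rowWeight G) (suc lo) d · (row-r · lab z) ≡ prodFrom (rowWeight G) (suc lo) (suc d)
    G-rows = trans (cong (prodFrom (rowWeight G) (suc lo) d ·_) (sym (rowWeight-diag G r z (s≤s z≤n) ez)))
                   (sym (prodFrom-snoc (rowWeight G) (suc lo) d))
    q-exponent : g₁ + g₂ ≡ sumFrom circDiag (suc lo) (copyEnd lo (prevAC G lo (suc r)) ∸ suc lo)
    q-exponent = trans (sym (sumFrom-split-at circDiag (suc lo) s r (copyEnd-≥lo lo (prevAC G lo r)) (copyEnd≤ r lr)))
                       (cong (λ v → sumFrom circDiag (suc lo) (v ∸ suc lo)) (sym end-r))

  partial : ∀ d → lo + d ≤ n → weight (lo + d) F · pending (lo + d) ≡ accounted d (lo + d)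
  partial zero le rewrite +-identityʳ lo = partial-base
  partial (suc d) le rewrite +-suc lo d with isAC? (G (suc (lo + d)) (suc (lo + d)))
  ... | inj₂ bd = partial-stepBD d le bd (partial d (≤-trans (n≤1+n _) le))
  ... | inj₁ ac with diagLabelled (suc (lo + d)) (s≤s z≤n) (m≤n⇒m≤1+n le)
  ...   | z , ez = partial-stepAC d z le ac ez (partial d (≤-trans (n≤1+n _) le))

  -- The whole tableau: the top row n+1 is the α/γ row L_{n+1}(x), which
  -- absorbs the last pending prefix.
  weight-shifted : ∀ x → G (suc n) (suc n) ≡ just x → isAC (just x) ≡ true →
                   weight (suc n) F ≡ weight lo F · prodFrom (rowWeight G) (suc lo) (n ∸ lo) · rowWeight G lo
                                      · qPow (sumFrom circDiag (suc lo) (n ∸ lo)) · lab x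
  weight-shifted x ex ax = begin
    weight n F · rowWeight F (suc n)
      ≡⟨ cong (weight n F ·_) (row-AC (suc n) x (s≤s lo≤n) ≤-refl (trans (cong isAC ex) ax) ex) ⟩
    weight n F · (pending n · qPow g₂ · lab x)
      ≡⟨ solve 4 (λ a b c e → a ⊕ ((b ⊕ c) ⊕ e) ⊜ ((a ⊕ b) ⊕ c) ⊕ e) refl (weight n F) (pending n) (qPow g₂) (lab x) ⟩
    weight n F · pending n · qPow g₂ · lab x
      ≡⟨ cong (λ w → w · qPow g₂ · lab x) all-rows ⟩
    accounted (n ∸ lo) n · qPow g₂ · lab x
      ≡⟨ cong (_· lab x) (·-assoc (weight lo F · prodFrom (rowWeight G) (suc lo) (n ∸ lo) · rowWeight G lo) (qPow g₁) (qPow g₂)) ⟩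
    weight lo F · prodFrom (rowWeight G) (suc lo) (n ∸ lo) · rowWeight G lo · qPow (g₁ + g₂) · lab x
      ≡⟨ cong (λ v → weight lo F · prodFrom (rowWeight G) (suc lo) (n ∸ lo) · rowWeight G lo · qPow v · lab x)
              (sym (sumFrom-split-at circDiag (suc lo) s (suc n) (copyEnd-≥lo lo (prevAC G lo (suc n))) (copyEnd≤ (suc n) (s≤s lo≤n)))) ⟩
    weight lo F · prodFrom (rowWeight G) (suc lo) (n ∸ lo) · rowWeight G lo · qPow (sumFrom circDiag (suc lo) (n ∸ lo)) · lab x ∎
    where
    open ≡-Reasoning
    s = copyEnd lo (prevAC G lo (suc n))
    g₁ = sumFrom circDiag (suc lo) (s ∸ suc lo)
    g₂ = sumFrom circDiag s (suc n ∸ s)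
    all-rows : weight n F · pending n ≡ accounted (n ∸ lo) n
    all-rows = subst (λ R → weight R F · pending R ≡ accounted (n ∸ lo) R) (m+[n∸m]≡n lo≤n)
                     (partial (n ∸ lo) (≤-reflexive (m+[n∸m]≡n lo≤n)))

typeOf-ext : ∀ H H' n → (∀ k → 1 ≤ k → k ≤ n → H k k ≡ H' k k) → typeOf n H ≡ typeOf n H'
typeOf-ext H H' zero    h = refl
typeOf-ext H H' (suc n) h =
  cong₂ _∷_ (cong diagMark (h (suc n) (s≤s z≤n) ≤-refl)) (typeOf-ext H H' n (λ k a b → h k a (m≤n⇒m≤1+n b)))

length-typeOf : ∀ n H → length (typeOf n H) ≡ n
length-typeOf zero    H = refl
length-typeOf (suc n) H = cong suc (length-typeOf n H)

-- the word m = U m_i V, for i = 1+i' and U of length k (rows above i)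
drop-typeOf : ∀ k i H → drop k (typeOf (k + i) H) ≡ typeOf i H
drop-typeOf zero    i H = refl
drop-typeOf (suc k) i H = drop-typeOf k i H

drop-typeOf-below : ∀ k i' H → drop (suc k) (typeOf (k + suc i') H) ≡ typeOf i' H
drop-typeOf-below zero    i' H = refl
drop-typeOf-below (suc k) i' H = drop-typeOf-below k i' H

take-typeOf-ext : ∀ k i H H' → (∀ j → i < j → j ≤ k + i → H j j ≡ H' j j) →
                  take k (typeOf (k + i) H) ≡ take k (typeOf (k + i) H')
take-typeOf-ext zero    i H H' h = refl
take-typeOf-ext (suc k) i H H' h =
  cong₂ _∷_ (cong diagMark (h (suc (k + i)) (s≤s (m≤n+m i k)) ≤-refl)) (take-typeOf-ext k i H H' (λ j a b → h j a (m≤n⇒m≤1+n b)))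

typeOf-split : ∀ k i' H → typeOf (k + suc i') H
               ≡ take k (typeOf (k + suc i') H) ++ diagMark (H (suc i') (suc i')) ∷ drop (suc k) (typeOf (k + suc i') H)
typeOf-split k i' H =
  trans (sym (take++drop≡id k (typeOf (k + suc i') H)))
        (cong (take k (typeOf (k + suc i') H) ++_)
              (trans (drop-typeOf k (suc i') H) (cong (diagMark (H (suc i') (suc i')) ∷_) (sym (drop-typeOf-below k i' H)))))

circMark : Mark → ℕ
circMark ● = 0
circMark ○ = 1

countCirc-∷ : ∀ m l → countCirc (m ∷ l) ≡ circMark m + countCirc l
countCirc-∷ ● l = refl
countCirc-∷ ○ l = refl

circMark-diag : ∀ z → circMark (diagMark (just z)) ≡ circ (just z)
circMark-diag α = refl
circMark-diag β = refl
circMark-diag γ = refl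
circMark-diag δ = refl

countCirc-take : ∀ k i H → (∀ j → i < j → j ≤ k + i → ∃ λ z → H j j ≡ just z) →
                 countCirc (take k (typeOf (k + i) H)) ≡ sumFrom (λ j → circ (H j j)) (suc i) k
countCirc-take zero    i H h = refl
countCirc-take (suc k) i H h with h (suc (k + i)) (s≤s (m≤n+m i k)) ≤-refl
... | z , e = begin
  countCirc (diagMark (H r r) ∷ take k (typeOf (k + i) H))
    ≡⟨ countCirc-∷ (diagMark (H r r)) (take k (typeOf (k + i) H)) ⟩
  circMark (diagMark (H r r)) + countCirc (take k (typeOf (k + i) H))
    ≡⟨ cong₂ _+_ (trans (cong (λ w → circMark (diagMark w)) e) (trans (circMark-diag z) (cong circ (sym e))))
                 (countCirc-take k i H (λ j a b → h j a (m≤n⇒m≤1+n b))) ⟩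
  circ (H r r) + sumFrom (λ j → circ (H j j)) (suc i) k
    ≡⟨ +-comm (circ (H r r)) _ ⟩
  sumFrom (λ j → circ (H j j)) (suc i) k + circ (H r r)
    ≡⟨ cong (λ w → sumFrom (λ j → circ (H j j)) (suc i) k + circ (H w w)) (cong suc (+-comm k i)) ⟩
  sumFrom (λ j → circ (H j j)) (suc i) k + circ (H (suc i + k) (suc i + k))
    ≡⟨ sym (sumFrom-snoc _ (suc i) k) ⟩
  sumFrom (λ j → circ (H j j)) (suc i) (suc k) ∎
  where
  open ≡-Reasoning
  r = suc (k + i)

take-all : ∀ n H → take n (typeOf n H) ≡ typeOf n H
take-all zero    H = refl
take-all (suc n) H = cong (diagMark (H (suc n) (suc n)) ∷_) (take-all n H)

addRow-weight : ∀ n z T → weight n (addRow n z T) ≡ weight n T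
addRow-weight n z T = weight-ext (addRow n z T) T n (λ k l _ _ kn → addRow-below n z T k l (<⇒≢ (s≤s kn)))

addRow-countCirc : ∀ n x T → IsStaircase n T → sumFrom (λ j → circ (addRow n x T j j)) 1 n ≡ countCirc (typeOf n T)
addRow-countCirc n x T S = begin
  sumFrom (λ j → circ (addRow n x T j j)) 1 n
    ≡⟨ sumFrom-ext _ _ 1 n (λ j a b → cong circ (addRow-below n x T j j (<⇒≢ b))) ⟩
  sumFrom (λ j → circ (T j j)) 1 n
    ≡⟨ sym (countCirc-take n 0 T (λ j a b → IsStaircase.diag S j a (subst (j ≤_) (+-identityʳ n) b))) ⟩
  countCirc (take n (typeOf (n + 0) T))
    ≡⟨ cong (λ m → countCirc (take n (typeOf m T))) (+-identityʳ n) ⟩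
  countCirc (take n (typeOf n T))
    ≡⟨ cong countCirc (take-all n T) ⟩
  countCirc (typeOf n T) ∎
  where open ≡-Reasoning

module Chain (n lo : ℕ) (x : Label) (T : Filling) (ax : isAC (just x) ≡ true) (lo≤n : lo ≤ n) where
  G = addRow n x T
  F₀ = shiftChain (suc n ∷ acRows G n lo) G
  open ChainSpec (chainSpec n (suc n) G lo ≤-refl)

  G-top : G (suc n) (suc n) ≡ just x
  G-top = addRow-diag n x T

  top-AC : isAC (G (suc n) (suc n)) ≡ true
  top-AC = trans (cong isAC G-top) ax

  G-below : ∀ r j → r ≤ n → G r j ≡ T r j
  G-below r j rn = addRow-below n x T r j (<⇒≢ (s≤s rn))

  F₀-BD : ∀ r j → 1 ≤ j → isAC (G r r) ≡ false → F₀ r j ≡ G r j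
  F₀-BD r j j1 bd = unchanged r j j1 (λ e → false≢true (trans (sym bd) (trans (cong (λ w → isAC (G w w)) e) top-AC)))
                              (inj₂ (inj₂ (inj₁ bd)))

  F₀-low : ∀ r j → 1 ≤ j → r ≤ lo → F₀ r j ≡ G r j
  F₀-low r j j1 rl = unchanged r j j1 (<⇒≢ (s≤s (≤-trans rl lo≤n))) (inj₁ rl)

  F₀-copied : ∀ r j → 1 ≤ j → lo < r → r ≤ suc n → isAC (G r r) ≡ true → lo < prevAC G lo r → j < prevAC G lo r →
              F₀ r j ≡ G (prevAC G lo r) j
  F₀-copied r j j1 lr rn ac lp jp with m≤n⇒m<n∨m≡n rn
  ... | inj₁ r<top = copied r j (<⇒≢ r<top) lr (s≤s⁻¹ r<top) ac lp j1 jp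
  ... | inj₂ refl  = top-copied j lp j1 jp

  F₀-emptied : ∀ r j → 1 ≤ j → lo < r → r ≤ suc n → isAC (G r r) ≡ true →
               (prevAC G lo r ≡ lo ⊎ prevAC G lo r ≤ j) → j < r → F₀ r j ≡ nothing
  F₀-emptied r j j1 lr rn ac c jr with m≤n⇒m<n∨m≡n rn
  ... | inj₁ r<top = emptied r j j1 (<⇒≢ r<top) lr (s≤s⁻¹ r<top) ac c jr
  ... | inj₂ refl  = trans (top-kept j j1 c) (addRow-offDiag n x T j (<⇒≢ jr))

  F₀-diag : ∀ r → lo < r → r ≤ suc n → F₀ r r ≡ G r r
  F₀-diag r lr rn with m≤n⇒m<n∨m≡n rn
  ... | inj₁ r<top = unchanged r r (≤-trans (s≤s z≤n) lr) (<⇒≢ r<top) (inj₂ (inj₂ (inj₂ ≤-refl)))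
  ... | inj₂ refl  = top-kept (suc n) (s≤s z≤n) (inj₂ (<⇒≤ (prevAC-< G lo (suc n) lr)))

module InsertAC (n : ℕ) (x : Label) (T : Filling) (S : IsStaircase n T) (ax : isAC (just x) ≡ true) where
  open Chain n 0 x T ax z≤n

  insertAC≡F₀ : insertAC n x T ≡ F₀
  insertAC≡F₀ = cong (λ l → shiftChain l G) (acRows-top n 0 x T ax (s≤s z≤n))

  shifted : Shifted n 0 G F₀
  shifted = record
    { extended     = addRow-extended n x T S ax
    ; lo≤n         = z≤n
    ; below-lo     = λ r j _ _ ()
    ; row-lo-empty = λ j _ ()
    ; BD-unchanged = λ r j j1 _ _ _ bd → F₀-BD r j j1 bd
    ; AC-copied    = λ r j j1 lr rn ac j<end → copied′ r j j1 lr rn ac (copyEnd-cases 0 (prevAC G 0 r) j z≤n j<end)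
    ; AC-gap       = λ r j lr rn ac end≤j jr →
                       F₀-emptied r j (≤-trans (copyEnd-≥lo 0 (prevAC G 0 r)) end≤j) lr rn ac
                                  (inj₂ (≤-trans (copyEnd-≥p 0 (prevAC G 0 r)) end≤j)) jr
    ; AC-diag      = λ r lr rn ac → F₀-diag r lr rn }
    where
    copied′ : ∀ r j → 1 ≤ j → 0 < r → r ≤ suc n → isAC (G r r) ≡ true →
              (0 < prevAC G 0 r × j < prevAC G 0 r) ⊎ (prevAC G 0 r ≡ 0 × j ≤ 0) → F₀ r j ≡ G (prevAC G 0 r) j
    copied′ r j j1 lr rn ac (inj₁ (a , b)) = F₀-copied r j j1 lr rn ac a b
    copied′ r (suc j) j1 lr rn ac (inj₂ (_ , ()))

  open ShiftedWeight n 0 G F₀ shifted using (weight-shifted)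

  weight-insertAC : weight (suc n) (insertAC n x T) ≡ qPow (countCirc (typeOf n T)) · lab x · weight n T
  weight-insertAC = begin
    weight (suc n) (insertAC n x T)
      ≡⟨ cong (weight (suc n)) insertAC≡F₀ ⟩
    weight (suc n) F₀
      ≡⟨ weight-shifted x G-top ax ⟩
    one · prodFrom (rowWeight G) 1 n · one · qPow (sumFrom (λ j → circ (G j j)) 1 n) · lab x
      ≡⟨ cong₂ (λ a b → one · a · one · qPow b · lab x)
               (trans (sym (prodRange≡prodFrom (rowWeight G) n)) (addRow-weight n x T)) (addRow-countCirc n x T S) ⟩
    one · weight n T · one · qPow (countCirc (typeOf n T)) · lab x
      ≡⟨ solve 3 (λ a b c → (((id ⊕ a) ⊕ id) ⊕ b) ⊕ c ⊜ (b ⊕ c) ⊕ a) refl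
               (weight n T) (qPow (countCirc (typeOf n T))) (lab x) ⟩
    qPow (countCirc (typeOf n T)) · lab x · weight n T ∎
    where open ≡-Reasoning

  type-insertAC : typeOf (suc n) (insertAC n x T) ≡ markOf x ∷ typeOf n T
  type-insertAC = trans (cong (typeOf (suc n)) insertAC≡F₀)
    (cong₂ _∷_ (cong diagMark (trans (F₀-diag (suc n) (s≤s z≤n) ≤-refl) G-top))
               (typeOf-ext F₀ T n (λ k a b → trans (F₀-diag k a (m≤n⇒m≤1+n b)) (G-below k k b))))

-- insertion(T, y) for y ∈ {β, δ}: the new row is empty left of c_{n+1}.
weight-insertBD : ∀ n y T → isAC (just y) ≡ false →
                  weight (suc n) (insertBD n y T) ≡ qPow (n * qCell (just y) nothing) · lab y · weight n T
weight-insertBD n y T bd =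
  trans (cong₂ _·_ (addRow-weight n y T)
                   (rowWeight-BD (addRow n y T) (suc n) y (s≤s z≤n) (λ j a b → addRow-offDiag n y T j (<⇒≢ b)) (addRow-diag n y T) bd))
        (·-comm (weight n T) _)

type-insertBD : ∀ n y T → typeOf (suc n) (insertBD n y T) ≡ markOf y ∷ typeOf n T
type-insertBD n y T =
  cong₂ _∷_ (cong diagMark (addRow-diag n y T)) (typeOf-ext (addRow n y T) T n (λ k a b → addRow-below n y T k k (<⇒≢ (s≤s b))))

record ChainEnd (G : Filling) (lo c : ℕ) : Set where
  field
    above-lo : lo < c
    isAC-c   : isAC (G c c) ≡ true
    prev-c   : prevAC G lo c ≡ lo

chainEnd : ∀ G lo m d → lo < d → isAC (G d d) ≡ true →
           (∀ k → m < k → k < d → lo < k → isAC (G k k) ≡ false) → ChainEnd G lo (lastOr d (acRows G m lo))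
chainEnd G lo zero d lo<d acd gap = record
  { above-lo = lo<d ; isAC-c = acd
  ; prev-c = prevAC-unique G lo d lo ≤-refl lo<d (λ x → ⊥-elim (<-irrefl refl x)) (λ k a b → gap k (≤-trans (s≤s z≤n) a) b a) }
chainEnd G lo (suc m) d lo<d acd gap with isAC (G (suc m) (suc m)) in eA | lo <ᵇ suc m in eL
... | true  | true  = chainEnd G lo m (suc m) (<ᵇ-sound eL) eA (λ k a b → ⊥-elim (<⇒≱ b a))
... | true  | false = chainEnd G lo m d lo<d acd gap′
  where
  gap′ : ∀ k → m < k → k < d → lo < k → isAC (G k k) ≡ false
  gap′ k a b c with m≤n⇒m<n∨m≡n a
  ... | inj₁ x    = gap k x b c
  ... | inj₂ refl = ⊥-elim (false≢true (trans (sym eL) (<ᵇ-true lo (suc m) c)))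
... | false | _     = chainEnd G lo m d lo<d acd gap′
  where
  gap′ : ∀ k → m < k → k < d → lo < k → isAC (G k k) ≡ false
  gap′ k a b c with m≤n⇒m<n∨m≡n a
  ... | inj₁ x    = gap k x b c
  ... | inj₂ refl = eA

module FinalMove (i c : ℕ) (i<c : i < c) (y : Label) (F : Filling) where
  F′ : Filling
  F′ = setDiag i y (moveRow i c F)

  F′-other : ∀ r j → r ≢ c → r ≢ i → F′ r j ≡ F r j
  F′-other r j p q rewrite ≡ᵇ-false r i q with (1 ≤ᵇ j) ∧ (j ≤ᵇ i)
  ... | false = refl
  ... | true rewrite ≡ᵇ-false r c p = refl

  F′-target : ∀ j → 1 ≤ j → j ≤ i → F′ c j ≡ F i j
  F′-target j a b rewrite ≡ᵇ-false c i (>⇒≢ i<c) | ≤ᵇ-true 1 j a | ≤ᵇ-true j i b | ≡ᵇ-true c = refl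

  F′-right : ∀ r j → i < j → r ≢ i → F′ r j ≡ F r j
  F′-right r j a q rewrite ≡ᵇ-false r i q | ≤ᵇ-false j i a | ∧-zeroʳ (1 ≤ᵇ j) = refl

  F′-source : ∀ j → 1 ≤ j → j < i → F′ i j ≡ nothing
  F′-source j a b rewrite ≡ᵇ-true i | ≡ᵇ-false j i (<⇒≢ b) | ≤ᵇ-true 1 j a | ≤ᵇ-true j i (<⇒≤ b)
                        | ≡ᵇ-false i c (<⇒≢ i<c) = refl

  F′-diag : F′ i i ≡ just y
  F′-diag rewrite ≡ᵇ-true i = refl

module InsertXYI (n : ℕ) (x y : Label) (T : Filling) (S : IsStaircase n T)
                 (ax : isAC (just x) ≡ true) (bdy : isAC (just y) ≡ false) (i' : ℕ) (i≤n : suc i' ≤ n) where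
  i = suc i'
  open Chain n i x T ax i≤n
  c = lastOr (suc n) (acRows G n i)
  open ChainEnd (chainEnd G i n (suc n) (s≤s i≤n) top-AC (λ k a b _ → ⊥-elim (<⇒≱ b a)))
    renaming (above-lo to i<c; isAC-c to AC-c)
  open FinalMove i c i<c y F₀

  insertXYI≡F′ : insertXYI n x y i T ≡ F′
  insertXYI≡F′ = cong (λ l → setDiag i y (moveRow i (lastOr (suc n) l) (shiftChain l G))) (acRows-top n i x T ax (s≤s i≤n))

  only-c : ∀ r → i < r → isAC (G r r) ≡ true → prevAC G i r ≡ i → r ≡ c
  only-c r i<r ac pr with <-cmp r c
  ... | tri< r<c _ _ = ⊥-elim (false≢true (trans (sym (prevAC-gap G i c r (subst (_< r) (sym prev-c) i<r) r<c)) ac))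
  ... | tri≈ _ e _   = e
  ... | tri> _ _ c<r = ⊥-elim (false≢true (trans (sym (prevAC-gap G i r c (subst (_< c) (sym pr) i<c) c<r)) AC-c))

  shifted : Shifted n i G F′
  shifted = record
    { extended     = addRow-extended n x T S ax
    ; lo≤n         = i≤n
    ; below-lo     = λ r j j1 jr r<i → trans (F′-other r j (<⇒≢ (<-trans r<i i<c)) (<⇒≢ r<i)) (F₀-low r j j1 (<⇒≤ r<i))
    ; row-lo-empty = λ j j1 j<i → F′-source j j1 j<i
    ; BD-unchanged = λ r j j1 jr i<r rn bd →
                       trans (F′-other r j (λ e → false≢true (trans (sym bd) (trans (cong (λ w → isAC (G w w)) e) AC-c))) (>⇒≢ i<r))
                             (F₀-BD r j j1 bd)
    ; AC-copied    = λ r j j1 i<r rn ac j<end → copied′ r j j1 i<r rn ac (copyEnd-cases i (prevAC G i r) j (prevAC-≥ G i r) j<end)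
    ; AC-gap       = λ r j i<r rn ac end≤j jr →
                       let i<j = ≤-trans (copyEnd-≥lo i (prevAC G i r)) end≤j in
                       trans (F′-right r j i<j (>⇒≢ i<r))
                             (F₀-emptied r j (≤-trans (s≤s z≤n) i<j) i<r rn ac
                                         (inj₂ (≤-trans (copyEnd-≥p i (prevAC G i r)) end≤j)) jr)
    ; AC-diag      = λ r i<r rn ac → trans (F′-right r r i<r (>⇒≢ i<r)) (F₀-diag r i<r rn) }
    where
    copied′ : ∀ r j → 1 ≤ j → i < r → r ≤ suc n → isAC (G r r) ≡ true →
              (i < prevAC G i r × j < prevAC G i r) ⊎ (prevAC G i r ≡ i × j ≤ i) → F′ r j ≡ G (prevAC G i r) j
    copied′ r j j1 i<r rn ac (inj₁ (i<p , j<p)) =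
      trans (F′-other r j (λ e → <⇒≢ i<p (sym (trans (cong (prevAC G i) e) prev-c))) (>⇒≢ i<r))
            (F₀-copied r j j1 i<r rn ac i<p j<p)
    copied′ r j j1 i<r rn ac (inj₂ (p≡i , j≤i)) with only-c r i<r ac p≡i
    ... | refl = trans (F′-target j j1 j≤i) (trans (F₀-low i j j1 ≤-refl) (cong (λ w → G w j) (sym p≡i)))

  open ShiftedWeight n i G F′ shifted using (weight-shifted)
  open Shifted shifted using (below-lo)
  open ShiftedCells n i G F′ shifted using (F-diag)

  k = n ∸ i
  k+i≡n : k + i ≡ n
  k+i≡n = m∸n+n≡m i≤n

  weight-T : weight n T ≡ weight i' G · rowWeight G i · prodFrom (rowWeight G) (suc i) k
  weight-T = begin
    weight n T                                                 ≡⟨ sym (addRow-weight n x T) ⟩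
    weight n G                                                 ≡⟨ prodRange≡prodFrom (rowWeight G) n ⟩
    prodFrom (rowWeight G) 1 n                                 ≡⟨ cong (prodFrom (rowWeight G) 1) (sym (m+[n∸m]≡n i≤n)) ⟩
    prodFrom (rowWeight G) 1 (i + k)                           ≡⟨ prodFrom-split (rowWeight G) 1 i k ⟩
    prodFrom (rowWeight G) 1 i · prodFrom (rowWeight G) (suc i) k
      ≡⟨ cong (_· prodFrom (rowWeight G) (suc i) k) (sym (prodRange≡prodFrom (rowWeight G) i)) ⟩
    weight i' G · rowWeight G i · prodFrom (rowWeight G) (suc i) k ∎
    where open ≡-Reasoning

  countCirc-U : sumFrom (λ j → circ (G j j)) (suc i) k ≡ countCirc (take k (typeOf n T))
  countCirc-U = begin
    sumFrom (λ j → circ (G j j)) (suc i) k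
      ≡⟨ sumFrom-ext _ _ (suc i) k (λ j _ j<end → cong circ (G-below j j (at-most-n j j<end))) ⟩
    sumFrom (λ j → circ (T j j)) (suc i) k
      ≡⟨ sym (countCirc-take k i T (λ j a b → IsStaircase.diag S j (≤-trans (s≤s z≤n) a) (subst (j ≤_) k+i≡n b))) ⟩
    countCirc (take k (typeOf (k + i) T))
      ≡⟨ cong (λ N → countCirc (take k (typeOf N T))) k+i≡n ⟩
    countCirc (take k (typeOf n T)) ∎
    where
    open ≡-Reasoning
    at-most-n : ∀ j → j < suc i + k → j ≤ n
    at-most-n j j<end = s≤s⁻¹ (subst (λ z → j < suc z) (trans (+-comm i k) k+i≡n) j<end)

  row-i : rowWeight F′ i ≡ qPow (i' * qCell (just y) nothing) · lab y
  row-i = rowWeight-BD F′ i y (s≤s z≤n) F′-source F′-diag bdy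

  rows-below-i : weight i' F′ ≡ weight i' G
  rows-below-i = weight-ext F′ G i' (λ a b c d f → below-lo a b c d (s≤s f))

  weight-insertXYI : weight (suc n) (insertXYI n x y i T)
                     ≡ qPow (countCirc (take k (typeOf n T)) + i' * qCell (just y) nothing) · lab x · lab y · weight n T
  weight-insertXYI = begin
    weight (suc n) (insertXYI n x y i T)
      ≡⟨ cong (weight (suc n)) insertXYI≡F′ ⟩
    weight (suc n) F′
      ≡⟨ weight-shifted x G-top ax ⟩
    weight i' F′ · rowWeight F′ i · prodFrom (rowWeight G) (suc i) k · rowWeight G i · qPow (sumFrom (λ j → circ (G j j)) (suc i) k) · lab x
      ≡⟨ cong₃ (λ a b e → a · b · prodFrom (rowWeight G) (suc i) k · rowWeight G i · qPow e · lab x) rows-below-i row-i countCirc-U ⟩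
    weight i' G · (qPow (i' * qy) · lab y) · prodFrom (rowWeight G) (suc i) k · rowWeight G i · qPow (countCirc (take k (typeOf n T))) · lab x
      ≡⟨ solve 7 (λ a b c d f g h → (((((a ⊕ (b ⊕ c)) ⊕ d) ⊕ f) ⊕ g) ⊕ h) ⊜ (((g ⊕ b) ⊕ h) ⊕ c) ⊕ ((a ⊕ f) ⊕ d)) refl
               (weight i' G) (qPow (i' * qy)) (lab y) (prodFrom (rowWeight G) (suc i) k) (rowWeight G i)
               (qPow (countCirc (take k (typeOf n T)))) (lab x) ⟩
    qPow (countCirc (take k (typeOf n T)) + i' * qy) · lab x · lab y · (weight i' G · rowWeight G i · prodFrom (rowWeight G) (suc i) k)
      ≡⟨ cong (qPow (countCirc (take k (typeOf n T)) + i' * qy) · lab x · lab y ·_) (sym weight-T) ⟩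
    qPow (countCirc (take k (typeOf n T)) + i' * qy) · lab x · lab y · weight n T ∎
    where
    open ≡-Reasoning
    qy = qCell (just y) nothing
    cong₃ : ∀ {A B C D : Set} (f : A → B → C → D) {a a' b b' c c'} → a ≡ a' → b ≡ b' → c ≡ c' → f a b c ≡ f a' b' c'
    cong₃ f refl refl refl = refl

  type-insertXYI : typeOf (suc n) (insertXYI n x y i T)
                   ≡ markOf x ∷ (take k (typeOf n T) ++ markOf y ∷ drop (suc k) (typeOf n T))
  type-insertXYI = trans (cong (typeOf (suc n)) insertXYI≡F′)
    (cong₂ _∷_ (cong diagMark (trans (F-diag (suc n) (s≤s i≤n) ≤-refl) G-top))
               (subst (λ N → typeOf N F′ ≡ take k (typeOf N T) ++ markOf y ∷ drop (suc k) (typeOf N T))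
                      k+i≡n split))
    where
    diag-above : ∀ j → i < j → j ≤ k + i → F′ j j ≡ T j j
    diag-above j a b = trans (F-diag j a (m≤n⇒m≤1+n (subst (j ≤_) k+i≡n b))) (G-below j j (subst (j ≤_) k+i≡n b))
    diag-below : ∀ j → 1 ≤ j → j ≤ i' → F′ j j ≡ T j j
    diag-below j a b = trans (below-lo j j a ≤-refl (s≤s b)) (G-below j j (≤-trans b (≤-trans (n≤1+n i') i≤n)))
    split : typeOf (k + i) F′ ≡ take k (typeOf (k + i) T) ++ markOf y ∷ drop (suc k) (typeOf (k + i) T)
    split = trans (typeOf-split k i' F′)
      (cong₂ _++_ (take-typeOf-ext k i F′ T diag-above)
        (cong₂ _∷_ (cong diagMark F′-diag)
          (trans (drop-typeOf-below k i' F′)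
                 (trans (typeOf-ext F′ T i' diag-below) (sym (drop-typeOf-below k i' T))))))

  length-V : length (drop (suc k) (typeOf n T)) ≡ i'
  length-V = begin
    length (drop (suc k) (typeOf n T))   ≡⟨ length-drop (suc k) (typeOf n T) ⟩
    length (typeOf n T) ∸ suc k          ≡⟨ cong (_∸ suc k) (length-typeOf n T) ⟩
    n ∸ suc k                            ≡⟨ cong (_∸ suc k) (sym k+i≡n) ⟩
    (k + suc i') ∸ suc k                 ≡⟨ cong (_∸ suc k) (+-suc k i') ⟩
    suc k + i' ∸ suc k                   ≡⟨ m+n∸m≡n (suc k) i' ⟩
    i' ∎
    where open ≡-Reasoning

weight-insertβ : ∀ n T → weight (suc n) (insertBD n β T) ≡ lab β · weight n T
weight-insertβ n T = trans (weight-insertBD n β T refl) (cong (λ e → qPow e · lab β · weight n T) (*-zeroʳ n))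

weight-insertδ : ∀ n T → weight (suc n) (insertBD n δ T) ≡ qPow n · lab δ · weight n T
weight-insertδ n T = trans (weight-insertBD n δ T refl) (cong (λ e → qPow e · lab δ · weight n T) (*-identityʳ n))

-- For y = β the emptied row i contributes no q ...
weight-insertXYβ : ∀ n x T → IsStaircase n T → isAC (just x) ≡ true → ∀ i → 1 ≤ i → i ≤ n →
                   weight (suc n) (insertXYI n x β i T) ≡ qPow (countCirc (take (n ∸ i) (typeOf n T))) · lab x · lab β · weight n T
weight-insertXYβ n x T S ax (suc i') _ i≤n =
  trans (InsertXYI.weight-insertXYI n x β T S ax refl i' i≤n)
        (cong (λ e → qPow e · lab x · lab β · weight n T)
              (trans (cong (countCirc (take (n ∸ suc i') (typeOf n T)) +_) (*-zeroʳ i')) (+-identityʳ _)))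

-- ... for y = δ it contributes q^{i-1} = q^{|V|}.
weight-insertXYδ : ∀ n x T → IsStaircase n T → isAC (just x) ≡ true → ∀ i → 1 ≤ i → i ≤ n →
                   weight (suc n) (insertXYI n x δ i T)
                   ≡ qPow (countCirc (take (n ∸ i) (typeOf n T)) + length (drop (suc (n ∸ i)) (typeOf n T))) · lab x · lab δ · weight n T
weight-insertXYδ n x T S ax (suc i') _ i≤n =
  trans (InsertXYI.weight-insertXYI n x δ T S ax refl i' i≤n)
        (cong (λ e → qPow (countCirc (take (n ∸ suc i') (typeOf n T)) + e) · lab x · lab δ · weight n T)
              (trans (*-identityʳ i') (sym (InsertXYI.length-V n x δ T S ax refl i' i≤n))))

type-insertXY : ∀ n x y T → IsStaircase n T → isAC (just x) ≡ true → isAC (just y) ≡ false → ∀ i → 1 ≤ i → i ≤ n →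
                typeOf (suc n) (insertXYI n x y i T)
                ≡ markOf x ∷ (take (n ∸ i) (typeOf n T) ++ markOf y ∷ drop (suc (n ∸ i)) (typeOf n T))
type-insertXY n x y T S ax bdy (suc i') _ i≤n = InsertXYI.type-insertXYI n x y T S ax bdy i' i≤n

proposition7 : (n : ℕ) → 1 ≤ n → (T : Filling) → IsStaircase n T →
    (weight (suc n) (insertAC n α T) ≡ qPow (countCirc (typeOf n T)) · lab α · weight n T
      × typeOf (suc n) (insertAC n α T) ≡ ● ∷ typeOf n T)
    × (weight (suc n) (insertBD n β T) ≡ lab β · weight n T
      × typeOf (suc n) (insertBD n β T) ≡ ○ ∷ typeOf n T)
    × (weight (suc n) (insertAC n γ T) ≡ qPow (countCirc (typeOf n T)) · lab γ · weight n T
      × typeOf (suc n) (insertAC n γ T) ≡ ○ ∷ typeOf n T)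
    × (weight (suc n) (insertBD n δ T) ≡ qPow n · lab δ · weight n T
      × typeOf (suc n) (insertBD n δ T) ≡ ● ∷ typeOf n T)
    × ((i : ℕ) → 1 ≤ i → i ≤ n →
      (weight (suc n) (insertXYI n α β i T)
          ≡ qPow (countCirc (take (n ∸ i) (typeOf n T))) · lab α · lab β · weight n T
        × typeOf (suc n) (insertXYI n α β i T)
          ≡ ● ∷ (take (n ∸ i) (typeOf n T) ++ ○ ∷ drop (suc (n ∸ i)) (typeOf n T)))
      × (weight (suc n) (insertXYI n γ β i T)
          ≡ qPow (countCirc (take (n ∸ i) (typeOf n T))) · lab γ · lab β · weight n T
        × typeOf (suc n) (insertXYI n γ β i T)
          ≡ ○ ∷ (take (n ∸ i) (typeOf n T) ++ ○ ∷ drop (suc (n ∸ i)) (typeOf n T)))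
      × (weight (suc n) (insertXYI n α δ i T)
          ≡ qPow (countCirc (take (n ∸ i) (typeOf n T)) + length (drop (suc (n ∸ i)) (typeOf n T)))
            · lab α · lab δ · weight n T
        × typeOf (suc n) (insertXYI n α δ i T)
          ≡ ● ∷ (take (n ∸ i) (typeOf n T) ++ ● ∷ drop (suc (n ∸ i)) (typeOf n T)))
      × (weight (suc n) (insertXYI n γ δ i T)
          ≡ qPow (countCirc (take (n ∸ i) (typeOf n T)) + length (drop (suc (n ∸ i)) (typeOf n T)))
            · lab γ · lab δ · weight n T
        × typeOf (suc n) (insertXYI n γ δ i T)
          ≡ ○ ∷ (take (n ∸ i) (typeOf n T) ++ ● ∷ drop (suc (n ∸ i)) (typeOf n T))))
proposition7 n _ T S =
  (InsertAC.weight-insertAC n α T S refl , InsertAC.type-insertAC n α T S refl) ,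
  (weight-insertβ n T , type-insertBD n β T) ,
  (InsertAC.weight-insertAC n γ T S refl , InsertAC.type-insertAC n γ T S refl) ,
  (weight-insertδ n T , type-insertBD n δ T) ,
  λ i 1≤i i≤n →
    (weight-insertXYβ n α T S refl i 1≤i i≤n , type-insertXY n α β T S refl refl i 1≤i i≤n) ,
    (weight-insertXYβ n γ T S refl i 1≤i i≤n , type-insertXY n γ β T S refl refl i 1≤i i≤n) ,
    (weight-insertXYδ n α T S refl i 1≤i i≤n , type-insertXY n α δ T S refl refl i 1≤i i≤n) ,
    (weight-insertXYδ n γ T S refl i 1≤i i≤n , type-insertXY n γ δ T S refl refl i 1≤i i≤n)
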